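{- Let $G=G_0\oplus_\phi G_1$, where $G_0$ and $G_1$ are disjoint graphs each isomorphic to $G(8,4)$ and $\phi:V(G_0)\to V(G_1)$ is a bijection (so $G\in RHL_4$). If $fsmp(G)=3$, then there exists a remainder set $R$ of $G_0$ such that the graph $G_1-\phi(R)$ contains at most one edge.
   Context: For disjoint graphs $G_0,G_1$ of the same order and a bijection $\phi:V(G_0)\to V(G_1)$, $G_0\oplus_\phi G_1$ is the graph with vertex set $V(G_0)\cup V(G_1)$ and edge set $E(G_0)\cup E(G_1)\cup\{v\phi(v): v\in V(G_0)\}$. $G(8,4)$ is the graph with vertex set $\{v_0,\dots,v_7\}$ and edges $v_iv_j$ whenever $j\equiv i+1$ or $j\equiv i+4 \pmod 8$. A remainder set of a graph $H\cong G(8,4)$ is a set of four vertices occupying the same position, up to isomorphism, as the four isolated vertices of $G(8,4)-F-S$ where $F$ is an FSMP set of $G(8,4)$ of size 2 and $S$ is a set of 3 vertices with $G(8,4)-F-S$ having 4 isolated vertices; explicitly, $R\subseteq V(H)$ is a remainder set iff there is an isomorphism $\psi:H\to G(8,4)$ with $\psi(R)=\{v_0,v_1,v_3,v_6\}$. $G_1-\phi(R)$ denotes $G_1$ with the vertex set $\phi(R)$ deleted. A fractional perfect matching of a graph $H$ is a function $f:E(H)\to[0,1]$ with $\sum_{e\ni v}f(e)=1$ for every vertex $v$. A set $F$ of vertices and/or edges of $H$ is a fractional strong matching preclusion (FSMP) set if $H-F$ has no fractional perfect matching; $fsmp(H)$ is the minimum size of an FSMP set.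
   Formalization: Fractional perfect matchings take rational values in $[0,1]$. -}

module Defs where

open import Data.Nat using (ℕ; zero; suc; _+_; _∸_; _≤_; _≡ᵇ_; _<ᵇ_)
open import Data.Nat.DivMod using (_%_)
open import Data.Fin using (Fin; toℕ; splitAt; _≟_)
import Data.Fin as F
open import Data.Bool using (Bool; true; false; _∧_; _∨_; not; if_then_else_)
open import Data.Sum using (_⊎_; inj₁; inj₂)
open import Data.Product using (Σ; _×_; ∃)
open import Data.Rational using (ℚ; 0ℚ; 1ℚ) renaming (_+_ to _+ℚ_; _≤_ to _≤ℚ_)
open import Relation.Nullary using (¬_; does)
open import Relation.Binary.PropositionalEquality using (_≡_)
open import Function.Bundles using (_↔_; Inverse)

-- Simplicity (symmetry, irreflexivity) of G0, G1 follows from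
-- their being isomorphic to G(8,4), so it is not required separately.
Graph : ℕ → Set
Graph n = Fin n → Fin n → Bool

count : ∀ {n} → (Fin n → Bool) → ℕ
count {zero}  p = 0
count {suc n} p = (if p F.zero then 1 else 0) + count (λ i → p (F.suc i))

sumℕ : ∀ {n} → (Fin n → ℕ) → ℕ
sumℕ {zero}  f = 0
sumℕ {suc n} f = f F.zero + sumℕ (λ i → f (F.suc i))

countPairs : ∀ {n} → (Fin n → Fin n → Bool) → ℕ
countPairs p = sumℕ (λ i → count (λ j → (toℕ i <ᵇ toℕ j) ∧ p i j))

sumℚ : ∀ {n} → (Fin n → ℚ) → ℚ
sumℚ {zero}  f = 0ℚ
sumℚ {suc n} f = f F.zero +ℚ sumℚ (λ i → f (F.suc i))

G84 : Graph 8
G84 i j = (d ≡ᵇ 1) ∨ (d ≡ᵇ 7) ∨ (d ≡ᵇ 4)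
  where d = (toℕ j + 8 ∸ toℕ i) % 8

IsIso : ∀ {n} → Graph n → Graph n → (Fin n ↔ Fin n) → Set
IsIso H K ψ = ∀ u v → H u v ≡ K (Inverse.to ψ u) (Inverse.to ψ v)

Isomorphic : ∀ {n} → Graph n → Graph n → Set
Isomorphic H K = Σ (Fin _ ↔ Fin _) (IsIso H K)

-- G0 ⊕_φ G1 on vertex set Fin 8 ⊎ Fin 8 ≅ Fin 16 (first 8 = V(G0), last 8 = V(G1))
_⊕[_]_ : Graph 8 → (Fin 8 ↔ Fin 8) → Graph 8 → Graph 16
(G0 ⊕[ φ ] G1) x y with splitAt 8 x | splitAt 8 y
... | inj₁ a | inj₁ b = G0 a b
... | inj₂ a | inj₂ b = G1 a b
... | inj₁ a | inj₂ b = does (Inverse.to φ a ≟ b)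
... | inj₂ a | inj₁ b = does (Inverse.to φ b ≟ a)

-- A set F of vertices and/or edges of H: delV = deleted vertices,
-- delE = deleted edges (symmetric relation contained in the edge relation).
record Deletion {n} (H : Graph n) : Set where
  field
    delV   : Fin n → Bool
    delE   : Fin n → Fin n → Bool
    delE-sym  : ∀ i j → delE i j ≡ delE j i
    delE-edge : ∀ i j → delE i j ≡ true → H i j ≡ true

  size : ℕ
  size = count delV + countPairs delE

  present : Fin n → Fin n → Bool
  present i j = H i j ∧ not (delE i j) ∧ not (delV i) ∧ not (delV j)

open Deletion public

-- fractional perfect matching of H - F: a weight on the edges of H - F
-- (encoded as a symmetric function on ordered pairs vanishing off edges)
-- with values in [0,1] summing to 1 at every surviving vertex.
record FracPerfectMatching {n} {H : Graph n} (D : Deletion H) : Set where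
  field
    w       : Fin n → Fin n → ℚ
    w-sym   : ∀ i j → w i j ≡ w j i
    w-lo    : ∀ i j → 0ℚ ≤ℚ w i j
    w-hi    : ∀ i j → w i j ≤ℚ 1ℚ
    w-supp  : ∀ i j → present D i j ≡ false → w i j ≡ 0ℚ
    w-sum   : ∀ i → delV D i ≡ false → sumℚ (w i) ≡ 1ℚ

IsFSMP : ∀ {n} {H : Graph n} → Deletion H → Set
IsFSMP D = ¬ FracPerfectMatching D

FsmpEq : ∀ {n} → Graph n → ℕ → Set
FsmpEq H k =
  (Σ (Deletion H) λ D → IsFSMP D × size D ≡ k) ×
  (∀ (D : Deletion H) → IsFSMP D → k ≤ size D)

inRem : Fin 8 → Bool
inRem v = (toℕ v ≡ᵇ 0) ∨ (toℕ v ≡ᵇ 1) ∨ (toℕ v ≡ᵇ 3) ∨ (toℕ v ≡ᵇ 6)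

IsRemainderSet : Graph 8 → (Fin 8 → Bool) → Set
IsRemainderSet H R =
  Σ (Fin 8 ↔ Fin 8) λ ψ → IsIso H G84 ψ × (∀ v → R v ≡ inRem (Inverse.to ψ v))

edgesAfterRemoving : Graph 8 → (Fin 8 ↔ Fin 8) → (Fin 8 → Bool) → ℕ
edgesAfterRemoving G1 φ R =
  countPairs (λ i j → G1 i j ∧ not (R (Inverse.from φ i)) ∧ not (R (Inverse.from φ j)))

-- Transport G to G(8,4) ⊕_φ G(8,4) and let F be an FSMP set of size 3. A permutation σ of the
-- surviving vertices moving each one along a surviving edge (a perfect 2-matching) gives a fractional
-- perfect matching, with weight ½ on the edges i σ(i). If each copy of G(8,4) contains at most one
-- element of F, both copies minus F have perfect 2-matchings. Otherwise one copy contains two or three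
-- elements of F, and a certified search shows that it becomes 2-matchable after removing one or two
-- further vertices a, which are matched to φ(a) in the other copy. With three elements this always
-- succeeds. With two, every vertex outside some remainder set R may be removed; the third element of F
-- blocks all of them only if it is an edge of the other copy for which every vertex of some remainder
-- set R′ may be removed, and φ sends the four vertices outside R to the four vertices outside R′.
-- These span a single edge.

module Submission where

open import Defs
open import Data.Nat using (ℕ; zero; suc; _+_; _*_; _≤_; _<ᵇ_; z≤n; s≤s; _≤?_)
import Data.Nat as ℕ
open import Data.Nat.Properties
  using ( +-assoc; +-identityʳ; +-cancelˡ-≡; +-cancelʳ-≡; *-cancelˡ-≡; +-cancelˡ-≤; +-monoˡ-≤
        ; ≤-trans; ≤-pred; m≤m+n; m≤n+m; m≤n⇒m≤1+n; n≮n; ≰⇒>; m+n≡0⇒m≡0; m+n≡0⇒n≡0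
        ; +-0-commutativeMonoid; +-commutativeSemigroup )
open import Data.Nat.Solver using (module +-*-Solver)
open import Data.Fin using (Fin; toℕ; #_; _↑ˡ_; _↑ʳ_; splitAt; _≟_)
import Data.Fin as F
open import Data.Fin.Patterns
open import Data.Fin.Properties using (suc-injective; splitAt-↑ˡ; splitAt-↑ʳ; join-splitAt; +↔⊎; all?; any?)
open import Data.Bool using (Bool; true; false; _∧_; _∨_; not; if_then_else_)
import Data.Bool.Properties as Bool
open import Data.Rational using (ℚ; 0ℚ; 1ℚ; ½) renaming (_+_ to _+ℚ_; _≤_ to _≤ℚ_)
import Data.Rational.Properties as ℚ
open import Data.Maybe using (Maybe; just; nothing; maybe′; zipWith; _<∣>_; from-just)
import Data.Maybe as Maybe
open import Data.List using (List; []; _∷_; foldr)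
open import Data.Vec using (Vec; []; _∷_; lookup; tabulate)
open import Data.Vec.Properties using (lookup∘tabulate)
open import Data.Product using (Σ; _×_; _,_; proj₁; proj₂; uncurry)
import Data.Product.Properties as Product
open import Data.Sum using (_⊎_; inj₁; inj₂; [_,_]′; map₂)
import Data.Sum as Sum
open import Data.Sum.Properties using (swap-↔)
open import Data.Sum.Function.Propositional using (_⊎-↔_)
open import Data.Empty using (⊥-elim)
open import Relation.Binary.PropositionalEquality
open import Relation.Nullary using (Dec; yes; no; does; ¬_)
open import Relation.Nullary.Decidable using (dec-true; dec-false; toWitness; dec⇒maybe; _×-dec_; _⊎-dec_; _→-dec_)
open import Function using (case_of_)
open import Function.Bundles using (_↔_; Inverse; mk↔ₛ′)
open import Function.Properties.Inverse using (↔-sym; ↔-trans)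
import Algebra.Properties.CommutativeMonoid.Sum as CommutativeMonoidSum
open import Algebra.Properties.CommutativeSemigroup +-commutativeSemigroup using (xy∙z≈xz∙y; interchange)

open Inverse using (to; from; strictlyInverseˡ; strictlyInverseʳ)
open +-*-Solver using (solve; _:+_; _:=_; con)

-- Finite sums and counts

fromBool : Bool → ℕ
fromBool b = if b then 1 else 0

sumℕ-cong : ∀ {n} {f g : Fin n → ℕ} → (∀ i → f i ≡ g i) → sumℕ f ≡ sumℕ g
sumℕ-cong {zero}  f≗g = refl
sumℕ-cong {suc n} f≗g = cong₂ _+_ (f≗g F.zero) (sumℕ-cong (λ i → f≗g (F.suc i)))

sumℚ-cong : ∀ {n} {f g : Fin n → ℚ} → (∀ i → f i ≡ g i) → sumℚ f ≡ sumℚ g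
sumℚ-cong {zero}  f≗g = refl
sumℚ-cong {suc n} f≗g = cong₂ _+ℚ_ (f≗g F.zero) (sumℚ-cong (λ i → f≗g (F.suc i)))

count-cong : ∀ {n} {p q : Fin n → Bool} → (∀ i → p i ≡ q i) → count p ≡ count q
count-cong {zero}  p≗q = refl
count-cong {suc n} p≗q = cong₂ _+_ (cong fromBool (p≗q F.zero)) (count-cong (λ i → p≗q (F.suc i)))

countPairs-cong : ∀ {n} {p q : Fin n → Fin n → Bool} → (∀ i j → p i j ≡ q i j) → countPairs p ≡ countPairs q
countPairs-cong p≗q = sumℕ-cong (λ i → count-cong (λ j → cong (_ ∧_) (p≗q i j)))

count≡sumℕ : ∀ {n} (p : Fin n → Bool) → count p ≡ sumℕ (λ i → fromBool (p i))
count≡sumℕ {zero}  p = refl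
count≡sumℕ {suc n} p = cong (fromBool (p F.zero) +_) (count≡sumℕ (λ i → p (F.suc i)))

module ℕSum = CommutativeMonoidSum +-0-commutativeMonoid
module ℚSum = CommutativeMonoidSum ℚ.+-0-commutativeMonoid

sumℕ≡sum : ∀ {n} (f : Fin n → ℕ) → sumℕ f ≡ ℕSum.sum f
sumℕ≡sum {zero}  f = refl
sumℕ≡sum {suc n} f = cong (f F.zero +_) (sumℕ≡sum (λ i → f (F.suc i)))

sumℚ≡sum : ∀ {n} (f : Fin n → ℚ) → sumℚ f ≡ ℚSum.sum f
sumℚ≡sum {zero}  f = refl
sumℚ≡sum {suc n} f = cong (f F.zero +ℚ_) (sumℚ≡sum (λ i → f (F.suc i)))

sumℕ-permute : ∀ {n} (f : Fin n → ℕ) (π : Fin n ↔ Fin n) → sumℕ (λ i → f (to π i)) ≡ sumℕ f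
sumℕ-permute f π = begin
  sumℕ (λ i → f (to π i))    ≡⟨ sumℕ≡sum (λ i → f (to π i)) ⟩
  ℕSum.sum (λ i → f (to π i)) ≡⟨ ℕSum.sum-permute f π ⟨
  ℕSum.sum f                  ≡⟨ sumℕ≡sum f ⟨
  sumℕ f                      ∎
  where open ≡-Reasoning

sumℚ-permute : ∀ {n} (f : Fin n → ℚ) (π : Fin n ↔ Fin n) → sumℚ (λ i → f (to π i)) ≡ sumℚ f
sumℚ-permute f π = begin
  sumℚ (λ i → f (to π i))    ≡⟨ sumℚ≡sum (λ i → f (to π i)) ⟩
  ℚSum.sum (λ i → f (to π i)) ≡⟨ ℚSum.sum-permute f π ⟨
  ℚSum.sum f                  ≡⟨ sumℚ≡sum f ⟨
  sumℚ f                      ∎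
  where open ≡-Reasoning

count-permute : ∀ {n} (p : Fin n → Bool) (π : Fin n ↔ Fin n) → count (λ i → p (to π i)) ≡ count p
count-permute p π = begin
  count (λ i → p (to π i))              ≡⟨ count≡sumℕ (λ i → p (to π i)) ⟩
  sumℕ (λ i → fromBool (p (to π i)))    ≡⟨ sumℕ-permute (λ i → fromBool (p i)) π ⟩
  sumℕ (λ i → fromBool (p i))           ≡⟨ count≡sumℕ p ⟨
  count p                               ∎
  where open ≡-Reasoning

sumℕ-distrib-+ : ∀ {n} (f g : Fin n → ℕ) → sumℕ (λ i → f i + g i) ≡ sumℕ f + sumℕ g
sumℕ-distrib-+ f g = begin
  sumℕ (λ i → f i + g i)          ≡⟨ sumℕ≡sum (λ i → f i + g i) ⟩
  ℕSum.sum (λ i → f i + g i)      ≡⟨ ℕSum.∑-distrib-+ f g ⟩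
  ℕSum.sum f + ℕSum.sum g         ≡⟨ cong₂ _+_ (sumℕ≡sum f) (sumℕ≡sum g) ⟨
  sumℕ f + sumℕ g                 ∎
  where open ≡-Reasoning

sumℚ-distrib-+ : ∀ {n} (f g : Fin n → ℚ) → sumℚ (λ i → f i +ℚ g i) ≡ sumℚ f +ℚ sumℚ g
sumℚ-distrib-+ f g = begin
  sumℚ (λ i → f i +ℚ g i)         ≡⟨ sumℚ≡sum (λ i → f i +ℚ g i) ⟩
  ℚSum.sum (λ i → f i +ℚ g i)     ≡⟨ ℚSum.∑-distrib-+ f g ⟩
  ℚSum.sum f +ℚ ℚSum.sum g        ≡⟨ cong₂ _+ℚ_ (sumℚ≡sum f) (sumℚ≡sum g) ⟨
  sumℚ f +ℚ sumℚ g                ∎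
  where open ≡-Reasoning

sumℕ-zero : ∀ {n} (f : Fin n → ℕ) → (∀ i → f i ≡ 0) → sumℕ f ≡ 0
sumℕ-zero {zero}  f f≡0 = refl
sumℕ-zero {suc n} f f≡0 = cong₂ _+_ (f≡0 F.zero) (sumℕ-zero (λ i → f (F.suc i)) (λ i → f≡0 (F.suc i)))

sumℚ-zero : ∀ {n} (f : Fin n → ℚ) → (∀ i → f i ≡ 0ℚ) → sumℚ f ≡ 0ℚ
sumℚ-zero {zero}  f f≡0 = refl
sumℚ-zero {suc n} f f≡0 = cong₂ _+ℚ_ (f≡0 F.zero) (sumℚ-zero (λ i → f (F.suc i)) (λ i → f≡0 (F.suc i)))

sumℕ-single : ∀ {n} (f : Fin n → ℕ) (k : Fin n) → (∀ i → i ≢ k → f i ≡ 0) → sumℕ f ≡ f k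
sumℕ-single f F.zero f≡0 =
  trans (cong (f F.zero +_) (sumℕ-zero _ (λ i → f≡0 (F.suc i) λ ()))) (+-identityʳ _)
sumℕ-single f (F.suc k) f≡0 =
  cong₂ _+_ (f≡0 F.zero λ ()) (sumℕ-single (λ i → f (F.suc i)) k (λ i i≢k → f≡0 (F.suc i) (λ e → i≢k (suc-injective e))))

sumℚ-single : ∀ {n} (f : Fin n → ℚ) (k : Fin n) → (∀ i → i ≢ k → f i ≡ 0ℚ) → sumℚ f ≡ f k
sumℚ-single f F.zero f≡0 =
  trans (cong (f F.zero +ℚ_) (sumℚ-zero _ (λ i → f≡0 (F.suc i) λ ()))) (ℚ.+-identityʳ _)
sumℚ-single f (F.suc k) f≡0 =
  trans (cong₂ _+ℚ_ (f≡0 F.zero λ ())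
                    (sumℚ-single (λ i → f (F.suc i)) k (λ i i≢k → f≡0 (F.suc i) (λ e → i≢k (suc-injective e)))))
        (ℚ.+-identityˡ _)

count-single : ∀ {n} (p : Fin n → Bool) (k : Fin n) → (∀ i → p i ≡ true → i ≡ k) → count p ≡ fromBool (p k)
count-single p k onlyAt-k = trans (count≡sumℕ p) (sumℕ-single (λ i → fromBool (p i)) k absent)
  where
    absent : ∀ i → i ≢ k → fromBool (p i) ≡ 0
    absent i i≢k with p i in pi
    ... | true  = ⊥-elim (i≢k (onlyAt-k i pi))
    ... | false = refl

count-false : ∀ {n} (p : Fin n → Bool) → (∀ i → p i ≡ false) → count p ≡ 0
count-false {zero}  p p≡false = refl
count-false {suc n} p p≡false rewrite p≡false F.zero = count-false (λ i → p (F.suc i)) (λ i → p≡false (F.suc i))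

count≡0⇒false : ∀ {n} (p : Fin n → Bool) → count p ≡ 0 → ∀ i → p i ≡ false
count≡0⇒false {suc n} p c≡0 i with p F.zero in p0
count≡0⇒false p c≡0 F.zero    | false = p0
count≡0⇒false p c≡0 (F.suc i) | false = count≡0⇒false (λ i → p (F.suc i)) c≡0 i

count-mono : ∀ {n} {p q : Fin n → Bool} → (∀ i → p i ≡ true → q i ≡ true) → count p ≤ count q
count-mono {zero}          p⊆q = z≤n
count-mono {suc n} {p} {q} p⊆q with p F.zero in p0 | q F.zero in q0
... | true  | true  = s≤s (count-mono (λ i → p⊆q (F.suc i)))
... | false | true  = m≤n⇒m≤1+n (count-mono (λ i → p⊆q (F.suc i)))
... | false | false = count-mono (λ i → p⊆q (F.suc i))
... | true  | false with () ← trans (sym (p⊆q F.zero p0)) q0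

count-mono-≡ : ∀ {n} {p q : Fin n → Bool} → (∀ i → p i ≡ true → q i ≡ true) → count p ≡ count q → ∀ i → p i ≡ q i
count-mono-≡ {suc n} {p} {q} p⊆q p≈q i with p F.zero in p0 | q F.zero in q0
count-mono-≡ p⊆q p≈q F.zero    | true  | true  = trans p0 (sym q0)
count-mono-≡ p⊆q p≈q F.zero    | false | false = trans p0 (sym q0)
count-mono-≡ p⊆q p≈q (F.suc i) | true  | true  = count-mono-≡ (λ i → p⊆q (F.suc i)) (cong ℕ.pred p≈q) i
count-mono-≡ p⊆q p≈q (F.suc i) | false | false = count-mono-≡ (λ i → p⊆q (F.suc i)) p≈q i
count-mono-≡ p⊆q p≈q i         | true  | false with () ← trans (sym (p⊆q F.zero p0)) q0
count-mono-≡ p⊆q p≈q i         | false | true  =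
  ⊥-elim (n≮n _ (subst (_≤ _) p≈q (count-mono (λ i → p⊆q (F.suc i)))))

count-tail≤ : ∀ {n} (p : Fin (suc n) → Bool) → count (λ i → p (F.suc i)) ≤ count p
count-tail≤ p = m≤n+m _ (fromBool (p F.zero))

1≤count : ∀ {n} (p : Fin n → Bool) {i : Fin n} → p i ≡ true → 1 ≤ count p
1≤count p {F.zero}  pi rewrite pi = s≤s z≤n
1≤count p {F.suc i} pi = ≤-trans (1≤count (λ k → p (F.suc k)) pi) (count-tail≤ p)

2≤count : ∀ {n} (p : Fin n → Bool) {i j : Fin n} → p i ≡ true → p j ≡ true → i ≢ j → 2 ≤ count p
2≤count p {F.zero}  {F.zero}  pi pj i≢j = ⊥-elim (i≢j refl)
2≤count p {F.zero}  {F.suc j} pi pj i≢j rewrite pi = s≤s (1≤count (λ k → p (F.suc k)) pj)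
2≤count p {F.suc i} {F.zero}  pi pj i≢j rewrite pj = s≤s (1≤count (λ k → p (F.suc k)) pi)
2≤count p {F.suc i} {F.suc j} pi pj i≢j =
  ≤-trans (2≤count (λ k → p (F.suc k)) pi pj (λ i≡j → i≢j (cong F.suc i≡j))) (count-tail≤ p)

count-↑ : ∀ m n (p : Fin (m + n) → Bool) → count p ≡ count (λ i → p (i ↑ˡ n)) + count (λ j → p (m ↑ʳ j))
count-↑ zero    n p = refl
count-↑ (suc m) n p =
  trans (cong (fromBool (p F.zero) +_) (count-↑ m n (λ i → p (F.suc i)))) (sym (+-assoc (fromBool (p F.zero)) _ _))

sumℕ-↑ : ∀ m n (f : Fin (m + n) → ℕ) → sumℕ f ≡ sumℕ (λ i → f (i ↑ˡ n)) + sumℕ (λ j → f (m ↑ʳ j))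
sumℕ-↑ zero    n f = refl
sumℕ-↑ (suc m) n f = trans (cong (f F.zero +_) (sumℕ-↑ m n (λ i → f (F.suc i)))) (sym (+-assoc (f F.zero) _ _))

↑ˡ<ᵇ↑ˡ : ∀ {m} n (i j : Fin m) → (toℕ (i ↑ˡ n) <ᵇ toℕ (j ↑ˡ n)) ≡ (toℕ i <ᵇ toℕ j)
↑ˡ<ᵇ↑ˡ n F.zero    F.zero    = refl
↑ˡ<ᵇ↑ˡ n F.zero    (F.suc j) = refl
↑ˡ<ᵇ↑ˡ n (F.suc i) F.zero    = refl
↑ˡ<ᵇ↑ˡ n (F.suc i) (F.suc j) = ↑ˡ<ᵇ↑ˡ n i j

↑ˡ<ᵇ↑ʳ : ∀ {m n} (i : Fin m) (j : Fin n) → (toℕ (i ↑ˡ n) <ᵇ toℕ (m ↑ʳ j)) ≡ true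
↑ˡ<ᵇ↑ʳ F.zero    j = refl
↑ˡ<ᵇ↑ʳ (F.suc i) j = ↑ˡ<ᵇ↑ʳ i j

↑ʳ<ᵇ↑ˡ : ∀ {m n} (i : Fin n) (j : Fin m) → (toℕ (m ↑ʳ i) <ᵇ toℕ (j ↑ˡ n)) ≡ false
↑ʳ<ᵇ↑ˡ i F.zero    = refl
↑ʳ<ᵇ↑ˡ i (F.suc j) = ↑ʳ<ᵇ↑ˡ i j

↑ʳ<ᵇ↑ʳ : ∀ m {n} (i j : Fin n) → (toℕ (m ↑ʳ i) <ᵇ toℕ (m ↑ʳ j)) ≡ (toℕ i <ᵇ toℕ j)
↑ʳ<ᵇ↑ʳ zero    i j = refl
↑ʳ<ᵇ↑ʳ (suc m) i j = ↑ʳ<ᵇ↑ʳ m i j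

countPairs-↑ : ∀ m n (p : Fin (m + n) → Fin (m + n) → Bool) →
  countPairs p ≡ countPairs (λ i j → p (i ↑ˡ n) (j ↑ˡ n)) + countPairs (λ i j → p (m ↑ʳ i) (m ↑ʳ j))
                 + sumℕ (λ i → count (λ j → p (i ↑ˡ n) (m ↑ʳ j)))
countPairs-↑ m n p = begin
  countPairs p                                    ≡⟨ sumℕ-↑ m n row ⟩
  sumℕ (λ i → row (i ↑ˡ n)) + sumℕ (λ j → row (m ↑ʳ j))
    ≡⟨ cong₂ _+_ (sumℕ-cong rowˡ) (sumℕ-cong rowʳ) ⟩
  sumℕ (λ i → inner i + across i) + sumℕ innerʳ    ≡⟨ cong (_+ sumℕ innerʳ) (sumℕ-distrib-+ inner across) ⟩
  sumℕ inner + sumℕ across + sumℕ innerʳ           ≡⟨ xy∙z≈xz∙y (sumℕ inner) _ _ ⟩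
  sumℕ inner + sumℕ innerʳ + sumℕ across           ∎
  where
    open ≡-Reasoning
    row : Fin (m + n) → ℕ
    row i = count (λ j → (toℕ i <ᵇ toℕ j) ∧ p i j)
    inner across : Fin m → ℕ
    inner i = count (λ j → (toℕ i <ᵇ toℕ j) ∧ p (i ↑ˡ n) (j ↑ˡ n))
    across i = count (λ j → p (i ↑ˡ n) (m ↑ʳ j))
    innerʳ : Fin n → ℕ
    innerʳ i = count (λ j → (toℕ i <ᵇ toℕ j) ∧ p (m ↑ʳ i) (m ↑ʳ j))
    rowˡ : ∀ i → row (i ↑ˡ n) ≡ inner i + across i
    rowˡ i = trans (count-↑ m n _)
      (cong₂ _+_ (count-cong (λ j → cong (_∧ p (i ↑ˡ n) (j ↑ˡ n)) (↑ˡ<ᵇ↑ˡ n i j)))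
                 (count-cong (λ j → cong (_∧ p (i ↑ˡ n) (m ↑ʳ j)) (↑ˡ<ᵇ↑ʳ i j))))
    rowʳ : ∀ i → row (m ↑ʳ i) ≡ innerʳ i
    rowʳ i = trans (count-↑ m n _)
      (cong₂ _+_ (count-false _ (λ j → cong (_∧ p (m ↑ʳ i) (j ↑ˡ n)) (↑ʳ<ᵇ↑ˡ i j)))
                 (count-cong (λ j → cong (_∧ p (m ↑ʳ i) (m ↑ʳ j)) (↑ʳ<ᵇ↑ʳ m i j))))

orderedPairs : ∀ {n} → (Fin n → Fin n → Bool) → ℕ
orderedPairs p = sumℕ (λ i → count (p i))

orderedPairs-split : ∀ {n} (p : Fin n → Fin n → Bool) →
  orderedPairs p ≡ countPairs p + countPairs (λ i j → p j i) + count (λ i → p i i)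
orderedPairs-split {zero}  p = refl
orderedPairs-split {suc n} p = begin
  orderedPairs p
    ≡⟨ cong (p₀₀ + row₀ +_) (sumℕ-distrib-+ (λ i → fromBool (p (F.suc i) F.zero)) (λ i → count (p′ i))) ⟩
  (p₀₀ + row₀) + (sumℕ (λ i → fromBool (p (F.suc i) F.zero)) + orderedPairs p′)
    ≡⟨ cong (λ c → (p₀₀ + row₀) + (c + orderedPairs p′)) (count≡sumℕ (λ i → p (F.suc i) F.zero)) ⟨
  (p₀₀ + row₀) + (col₀ + orderedPairs p′)
    ≡⟨ cong (λ t → (p₀₀ + row₀) + (col₀ + t)) (orderedPairs-split p′) ⟩
  (p₀₀ + row₀) + (col₀ + (A + B + C))
    ≡⟨ solve 6 (λ p₀₀ row₀ col₀ A B C → (p₀₀ :+ row₀) :+ (col₀ :+ (A :+ B :+ C))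
                                       := (row₀ :+ A) :+ (col₀ :+ B) :+ (p₀₀ :+ C)) refl p₀₀ row₀ col₀ A B C ⟩
  (row₀ + A) + (col₀ + B) + (p₀₀ + C)
    ∎
  where
    open ≡-Reasoning
    p′ : Fin n → Fin n → Bool
    p′ i j = p (F.suc i) (F.suc j)
    p₀₀ row₀ col₀ A B C : ℕ
    p₀₀ = fromBool (p F.zero F.zero)
    row₀ = count (λ j → p F.zero (F.suc j))
    col₀ = count (λ i → p (F.suc i) F.zero)
    A = countPairs p′
    B = countPairs (λ i j → p′ j i)
    C = count (λ i → p′ i i)

countPairs-permute : ∀ {n} (p : Fin n → Fin n → Bool) (π : Fin n ↔ Fin n) → (∀ i j → p i j ≡ p j i) →
  countPairs (λ i j → p (to π i) (to π j)) ≡ countPairs p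
countPairs-permute {n} p π p-sym = *-cancelˡ-≡ _ _ 2 (+-cancelʳ-≡ (count (λ i → p i i)) _ _ (begin
  2 * countPairs pπ + count (λ i → p i i)        ≡⟨ cong (2 * countPairs pπ +_) (count-permute (λ i → p i i) π) ⟨
  2 * countPairs pπ + count (λ i → pπ i i)       ≡⟨ symmetric-split pπ (λ i j → p-sym _ _) ⟨
  orderedPairs pπ                                ≡⟨ sumℕ-cong (λ i → count-permute (p (to π i)) π) ⟩
  orderedPairs (λ i j → p (to π i) j)            ≡⟨ sumℕ-permute (λ i → count (p i)) π ⟩
  orderedPairs p                                 ≡⟨ symmetric-split p p-sym ⟩
  2 * countPairs p + count (λ i → p i i)         ∎))
  where
    open ≡-Reasoning
    pπ : Fin n → Fin n → Bool
    pπ i j = p (to π i) (to π j)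
    symmetric-split : ∀ {n} (q : Fin n → Fin n → Bool) → (∀ i j → q i j ≡ q j i) →
      orderedPairs q ≡ 2 * countPairs q + count (λ i → q i i)
    symmetric-split q q-sym = trans (orderedPairs-split q)
      (cong (λ c → countPairs q + c + count (λ i → q i i))
            (trans (countPairs-cong (λ i j → q-sym j i)) (sym (+-identityʳ _))))

infix 4 _==_

_==_ : ∀ {n} → Fin n → Fin n → Bool
i == j = does (i ≟ j)

==-refl : ∀ {n} (i : Fin n) → (i == i) ≡ true
==-refl i = dec-true (i ≟ i) refl

==⇒≡ : ∀ {n} {i j : Fin n} → (i == j) ≡ true → i ≡ j
==⇒≡ {i = i} {j} i==j with i ≟ j
... | yes i≡j = i≡j

≢⇒==-false : ∀ {n} {i j : Fin n} → i ≢ j → (i == j) ≡ false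
≢⇒==-false {i = i} {j} = dec-false (i ≟ j)

data Side {m n} : Fin (m + n) → Set where
  left  : ∀ i → Side (i ↑ˡ n)
  right : ∀ j → Side (m ↑ʳ j)

side : ∀ {m n} x → Side {m} {n} x
side {m} {n} x with splitAt m x | join-splitAt m n x
... | inj₁ i | refl = left i
... | inj₂ j | refl = right j

to-injective : ∀ {n} (ψ : Fin n ↔ Fin n) {a b : Fin n} → to ψ a ≡ to ψ b → a ≡ b
to-injective ψ {a} {b} e = trans (sym (strictlyInverseʳ ψ a)) (trans (cong (from ψ) e) (strictlyInverseʳ ψ b))

==-to : ∀ {n} (ψ : Fin n ↔ Fin n) (a b : Fin n) → (to ψ a == to ψ b) ≡ (a == b)
==-to ψ a b with a ≟ b
... | yes refl = ==-refl (to ψ a)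
... | no a≢b   = ≢⇒==-false (λ e → a≢b (to-injective ψ e))

==-sym : ∀ {n} (a b : Fin n) → (a == b) ≡ (b == a)
==-sym a b with a ≟ b
... | yes refl = sym (==-refl a)
... | no a≢b   = sym (≢⇒==-false (λ b≡a → a≢b (sym b≡a)))

==-from : ∀ {n} (ψ : Fin n ↔ Fin n) (a b : Fin n) → (from ψ b == a) ≡ (b == to ψ a)
==-from ψ a b = trans (sym (==-to ψ (from ψ b) a)) (cong (_== to ψ a) (strictlyInverseˡ ψ b))

==-↑ˡ : ∀ {m} n (i j : Fin m) → (i ↑ˡ n == j ↑ˡ n) ≡ (i == j)
==-↑ˡ n F.zero    F.zero    = refl
==-↑ˡ n F.zero    (F.suc j) = refl
==-↑ˡ n (F.suc i) F.zero    = refl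
==-↑ˡ n (F.suc i) (F.suc j) = ==-↑ˡ n i j

==-↑ʳ : ∀ m {n} (i j : Fin n) → (m ↑ʳ i == m ↑ʳ j) ≡ (i == j)
==-↑ʳ zero    i j = refl
==-↑ʳ (suc m) i j = ==-↑ʳ m i j

↑ˡ==↑ʳ : ∀ {m n} (i : Fin m) (j : Fin n) → (i ↑ˡ n == m ↑ʳ j) ≡ false
↑ˡ==↑ʳ F.zero    j = refl
↑ˡ==↑ʳ (F.suc i) j = ↑ˡ==↑ʳ i j

↑ʳ==↑ˡ : ∀ {m n} (j : Fin n) (i : Fin m) → (m ↑ʳ j == i ↑ˡ n) ≡ false
↑ʳ==↑ˡ j F.zero    = refl
↑ʳ==↑ˡ j (F.suc i) = ↑ʳ==↑ˡ j i

-- Transport along an isomorphism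

module _ {n} {H K : Graph n} (ψ : Fin n ↔ Fin n) (iso : IsIso H K ψ) where

  mapDeletion : Deletion H → Deletion K
  mapDeletion D = record
    { delV      = λ y → delV D (from ψ y)
    ; delE      = λ y z → delE D (from ψ y) (from ψ z)
    ; delE-sym  = λ y z → delE-sym D (from ψ y) (from ψ z)
    ; delE-edge = λ y z e → begin
        K y z                              ≡⟨ cong₂ K (strictlyInverseˡ ψ y) (strictlyInverseˡ ψ z) ⟨
        K (to ψ (from ψ y)) (to ψ (from ψ z)) ≡⟨ iso (from ψ y) (from ψ z) ⟨
        H (from ψ y) (from ψ z)            ≡⟨ delE-edge D _ _ e ⟩
        _                                  ∎
    }
    where open ≡-Reasoning

  size-mapDeletion : (D : Deletion H) → size (mapDeletion D) ≡ size D
  size-mapDeletion D =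
    cong₂ _+_ (count-permute (delV D) (↔-sym ψ)) (countPairs-permute (delE D) (↔-sym ψ) (delE-sym D))

  present-mapDeletion : (D : Deletion H) → ∀ i j → present (mapDeletion D) (to ψ i) (to ψ j) ≡ present D i j
  present-mapDeletion D i j rewrite strictlyInverseʳ ψ i | strictlyInverseʳ ψ j = cong (_∧ _) (sym (iso i j))

  pullbackFPM : (D : Deletion H) → FracPerfectMatching (mapDeletion D) → FracPerfectMatching D
  pullbackFPM D M = record
    { w      = λ i j → w (to ψ i) (to ψ j)
    ; w-sym  = λ i j → w-sym (to ψ i) (to ψ j)
    ; w-lo   = λ i j → w-lo _ _
    ; w-hi   = λ i j → w-hi _ _
    ; w-supp = λ i j absent → w-supp _ _ (trans (present-mapDeletion D i j) absent)
    ; w-sum  = λ i kept → trans (sumℚ-permute (w (to ψ i)) ψ)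
                                (w-sum (to ψ i) (trans (cong (delV D) (strictlyInverseʳ ψ i)) kept))
    }
    where open FracPerfectMatching M

-- Perfect 2-matchings

Moves : ∀ {n} → Graph n → (Fin n → Bool) → (Fin n → Fin n → Bool) → (σ τ : Fin n → Fin n) → Fin n → Set
Moves H X Ed σ τ i =
  X (σ i) ≡ false × H i (σ i) ≡ true × Ed i (σ i) ≡ false × τ (σ i) ≡ i × X (τ i) ≡ false × σ (τ i) ≡ i

-- A permutation σ (inverse τ) of the surviving vertices of H − X − Ed moving every vertex along a
-- surviving edge; its orbits are disjoint edges and cycles covering all surviving vertices.
record Perfect2Matching {n} (H : Graph n) (X : Fin n → Bool) (Ed : Fin n → Fin n → Bool) : Set where
  field
    σ τ   : Fin n → Fin n
    moves : ∀ i → X i ≡ false → Moves H X Ed σ τ i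

  module _ (i : Fin n) (alive : X i ≡ false) where
    σ-alive : X (σ i) ≡ false
    σ-alive = proj₁ (moves i alive)
    σ-edge : H i (σ i) ≡ true
    σ-edge = proj₁ (proj₂ (moves i alive))
    σ-kept : Ed i (σ i) ≡ false
    σ-kept = proj₁ (proj₂ (proj₂ (moves i alive)))
    τ∘σ : τ (σ i) ≡ i
    τ∘σ = proj₁ (proj₂ (proj₂ (proj₂ (moves i alive))))
    τ-alive : X (τ i) ≡ false
    τ-alive = proj₁ (proj₂ (proj₂ (proj₂ (proj₂ (moves i alive)))))
    σ∘τ : σ (τ i) ≡ i
    σ∘τ = proj₂ (proj₂ (proj₂ (proj₂ (proj₂ (moves i alive)))))

half : Bool → ℚ
half b = if b then ½ else 0ℚ

-- Weight ½ on every edge i σ(i): each surviving vertex meets one such edge leaving it and one entering it.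
module _ {n} {H : Graph n} (H-sym : ∀ i j → H i j ≡ H j i) (D : Deletion H)
         (P : Perfect2Matching H (delV D) (delE D)) where

  open Perfect2Matching P

  private
    alive : Fin n → Bool
    alive x = not (delV D x)

    undeleted⇒alive : ∀ {x} → delV D x ≡ false → alive x ≡ true
    undeleted⇒alive dx = cong not dx

    alive⇒undeleted : ∀ {x} → alive x ≡ true → delV D x ≡ false
    alive⇒undeleted {x} a with delV D x
    ... | false = refl

    w : Fin n → Fin n → ℚ
    w x y = if alive x ∧ alive y then half (σ x == y) +ℚ half (σ y == x) else 0ℚ

    w-sym : ∀ x y → w x y ≡ w y x
    w-sym x y rewrite Bool.∧-comm (alive x) (alive y) with alive y ∧ alive x
    ... | true  = ℚ.+-comm (half (σ x == y)) (half (σ y == x))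
    ... | false = refl

    halves-lo : ∀ a b → 0ℚ ≤ℚ half a +ℚ half b
    halves-lo true  true  = toWitness {a? = 0ℚ ℚ.≤? ½ +ℚ ½} _
    halves-lo true  false = toWitness {a? = 0ℚ ℚ.≤? ½ +ℚ 0ℚ} _
    halves-lo false true  = toWitness {a? = 0ℚ ℚ.≤? 0ℚ +ℚ ½} _
    halves-lo false false = ℚ.≤-refl

    halves-hi : ∀ a b → half a +ℚ half b ≤ℚ 1ℚ
    halves-hi true  true  = ℚ.≤-refl
    halves-hi true  false = toWitness {a? = ½ +ℚ 0ℚ ℚ.≤? 1ℚ} _
    halves-hi false true  = toWitness {a? = 0ℚ +ℚ ½ ℚ.≤? 1ℚ} _
    halves-hi false false = toWitness {a? = 0ℚ ℚ.≤? 1ℚ} _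

    w-lo : ∀ x y → 0ℚ ≤ℚ w x y
    w-lo x y with alive x ∧ alive y
    ... | true  = halves-lo (σ x == y) (σ y == x)
    ... | false = ℚ.≤-refl

    w-hi : ∀ x y → w x y ≤ℚ 1ℚ
    w-hi x y with alive x ∧ alive y
    ... | true  = halves-hi (σ x == y) (σ y == x)
    ... | false = toWitness {a? = 0ℚ ℚ.≤? 1ℚ} _

    present-σ : ∀ x → delV D x ≡ false → present D x (σ x) ≡ true
    present-σ x dx rewrite σ-edge x dx | σ-kept x dx | dx | σ-alive x dx = refl

    present-sym : ∀ x y → present D x y ≡ present D y x
    present-sym x y rewrite H-sym x y | delE-sym D x y with delV D x | delV D y
    ... | true  | true  = refl
    ... | true  | false = refl
    ... | false | true  = refl
    ... | false | false = refl

    σ-avoids : ∀ x y → delV D x ≡ false → present D x y ≡ false → (σ x == y) ≡ false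
    σ-avoids x y dx absent with σ x ≟ y
    ... | no _     = refl
    ... | yes refl with () ← trans (sym (present-σ x dx)) absent

    w-vanishes : ∀ x y → (delV D x ≡ false → (σ x == y) ≡ false) → (delV D y ≡ false → (σ y == x) ≡ false) →
                 w x y ≡ 0ℚ
    w-vanishes x y σx≢y σy≢x with delV D x | delV D y
    ... | true  | _     = refl
    ... | false | true  = refl
    ... | false | false rewrite σx≢y refl | σy≢x refl = refl

    w-supp : ∀ x y → present D x y ≡ false → w x y ≡ 0ℚ
    w-supp x y absent = w-vanishes x y (λ dx → σ-avoids x y dx absent)
                                       (λ dy → σ-avoids y x dy (trans (present-sym y x) absent))

    w-row : ∀ x → delV D x ≡ false → ∀ y → w x y ≡ half (alive y ∧ (σ x == y)) +ℚ half (alive y ∧ (σ y == x))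
    w-row x dx y rewrite undeleted⇒alive dx with alive y
    ... | true  = refl
    ... | false = refl

    out-unique : ∀ x y → y ≢ σ x → half (alive y ∧ (σ x == y)) ≡ 0ℚ
    out-unique x y y≢σx rewrite ≢⇒==-false {i = σ x} (λ σx≡y → y≢σx (sym σx≡y)) with alive y
    ... | true  = refl
    ... | false = refl

    in-unique : ∀ x y → y ≢ τ x → half (alive y ∧ (σ y == x)) ≡ 0ℚ
    in-unique x y y≢τx with alive y in ay | σ y ≟ x
    ... | false | _        = refl
    ... | true  | no _     = refl
    ... | true  | yes refl = ⊥-elim (y≢τx (sym (τ∘σ y (alive⇒undeleted ay))))

    w-sum : ∀ x → delV D x ≡ false → sumℚ (w x) ≡ 1ℚ
    w-sum x dx = begin
      sumℚ (w x)
        ≡⟨ sumℚ-cong (w-row x dx) ⟩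
      sumℚ (λ y → half (alive y ∧ (σ x == y)) +ℚ half (alive y ∧ (σ y == x)))
        ≡⟨ sumℚ-distrib-+ (λ y → half (alive y ∧ (σ x == y))) (λ y → half (alive y ∧ (σ y == x))) ⟩
      sumℚ (λ y → half (alive y ∧ (σ x == y))) +ℚ sumℚ (λ y → half (alive y ∧ (σ y == x)))
        ≡⟨ cong₂ _+ℚ_ (sumℚ-single _ (σ x) (out-unique x)) (sumℚ-single _ (τ x) (in-unique x)) ⟩
      half (alive (σ x) ∧ (σ x == σ x)) +ℚ half (alive (τ x) ∧ (σ (τ x) == x))
        ≡⟨ cong₂ (λ a b → half a +ℚ half b)
                 (cong₂ _∧_ (undeleted⇒alive (σ-alive x dx)) (==-refl (σ x)))
                 (cong₂ _∧_ (undeleted⇒alive (τ-alive x dx)) (trans (cong (_== x) (σ∘τ x dx)) (==-refl x))) ⟩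
      ½ +ℚ ½
        ≡⟨⟩
      1ℚ ∎
      where open ≡-Reasoning

  perfect2Matching⇒fpm : FracPerfectMatching D
  perfect2Matching⇒fpm = record
    { w = w ; w-sym = w-sym ; w-lo = w-lo ; w-hi = w-hi ; w-supp = w-supp ; w-sum = w-sum }

Perfect2Matching-cong : ∀ {n} {H : Graph n} {X X′ : Fin n → Bool} {Ed Ed′ : Fin n → Fin n → Bool} →
  (∀ i → X i ≡ X′ i) → (∀ i j → Ed i j ≡ Ed′ i j) → Perfect2Matching H X Ed → Perfect2Matching H X′ Ed′
Perfect2Matching-cong {H = H} {X} {X′} {Ed} {Ed′} X≗X′ Ed≗Ed′ P = record { σ = σ ; τ = τ ; moves = moves′ }
  where
    open Perfect2Matching P
    moves′ : ∀ i → X′ i ≡ false → Moves H X′ Ed′ σ τ i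
    moves′ i alive with moves i (trans (X≗X′ i) alive)
    ... | σ-alive , σ-edge , σ-kept , τ∘σ , τ-alive , σ∘τ =
      trans (sym (X≗X′ (σ i))) σ-alive , σ-edge , trans (sym (Ed≗Ed′ i (σ i))) σ-kept ,
      τ∘σ , trans (sym (X≗X′ (τ i))) τ-alive , σ∘τ

-- The graphs G0 ⊕_φ G1

inl inr : Fin 8 → Fin 16
inl i = i ↑ˡ 8
inr j = 8 ↑ʳ j

module _ (G0 : Graph 8) (φ : Fin 8 ↔ Fin 8) (G1 : Graph 8) where

  ⊕-ll : ∀ i j → (G0 ⊕[ φ ] G1) (inl i) (inl j) ≡ G0 i j
  ⊕-ll i j rewrite splitAt-↑ˡ 8 i 8 | splitAt-↑ˡ 8 j 8 = refl

  ⊕-rr : ∀ i j → (G0 ⊕[ φ ] G1) (inr i) (inr j) ≡ G1 i j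
  ⊕-rr i j rewrite splitAt-↑ʳ 8 8 i | splitAt-↑ʳ 8 8 j = refl

  ⊕-lr : ∀ i j → (G0 ⊕[ φ ] G1) (inl i) (inr j) ≡ (to φ i == j)
  ⊕-lr i j rewrite splitAt-↑ˡ 8 i 8 | splitAt-↑ʳ 8 8 j = refl

  ⊕-rl : ∀ j i → (G0 ⊕[ φ ] G1) (inr j) (inl i) ≡ (to φ i == j)
  ⊕-rl j i rewrite splitAt-↑ˡ 8 i 8 | splitAt-↑ʳ 8 8 j = refl

  ⊕-sym : (∀ i j → G0 i j ≡ G0 j i) → (∀ i j → G1 i j ≡ G1 j i) → ∀ x y → (G0 ⊕[ φ ] G1) x y ≡ (G0 ⊕[ φ ] G1) y x
  ⊕-sym G0-sym G1-sym x y with side {8} {8} x | side {8} {8} y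
  ... | left i  | left j  rewrite ⊕-ll i j | ⊕-ll j i = G0-sym i j
  ... | right i | right j rewrite ⊕-rr i j | ⊕-rr j i = G1-sym i j
  ... | left i  | right j rewrite ⊕-lr i j | ⊕-rl j i = refl
  ... | right j | left i  rewrite ⊕-lr i j | ⊕-rl j i = refl

⊕-↔ : (ψ₀ ψ₁ : Fin 8 ↔ Fin 8) → Fin 16 ↔ Fin 16
⊕-↔ ψ₀ ψ₁ = ↔-trans +↔⊎ (↔-trans (ψ₀ ⊎-↔ ψ₁) (↔-sym +↔⊎))

⊕-↔-inl : ∀ ψ₀ ψ₁ i → to (⊕-↔ ψ₀ ψ₁) (inl i) ≡ inl (to ψ₀ i)
⊕-↔-inl ψ₀ ψ₁ i rewrite splitAt-↑ˡ 8 i 8 = refl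

⊕-↔-inr : ∀ ψ₀ ψ₁ j → to (⊕-↔ ψ₀ ψ₁) (inr j) ≡ inr (to ψ₁ j)
⊕-↔-inr ψ₀ ψ₁ j rewrite splitAt-↑ʳ 8 8 j = refl

conjugate : (ψ₀ φ ψ₁ : Fin 8 ↔ Fin 8) → Fin 8 ↔ Fin 8
conjugate ψ₀ φ ψ₁ = ↔-trans (↔-sym ψ₀) (↔-trans φ ψ₁)

⊕-cong : ∀ {G0 G1 H0 H1 : Graph 8} (ψ₀ φ ψ₁ : Fin 8 ↔ Fin 8) → IsIso G0 H0 ψ₀ → IsIso G1 H1 ψ₁ →
         IsIso (G0 ⊕[ φ ] G1) (H0 ⊕[ conjugate ψ₀ φ ψ₁ ] H1) (⊕-↔ ψ₀ ψ₁)
⊕-cong {G0} {G1} {H0} {H1} ψ₀ φ ψ₁ iso₀ iso₁ x y with side {8} {8} x | side {8} {8} y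
... | left i  | left j  rewrite ⊕-↔-inl ψ₀ ψ₁ i | ⊕-↔-inl ψ₀ ψ₁ j | ⊕-ll G0 φ G1 i j
                              | ⊕-ll H0 (conjugate ψ₀ φ ψ₁) H1 (to ψ₀ i) (to ψ₀ j) = iso₀ i j
... | right i | right j rewrite ⊕-↔-inr ψ₀ ψ₁ i | ⊕-↔-inr ψ₀ ψ₁ j | ⊕-rr G0 φ G1 i j
                              | ⊕-rr H0 (conjugate ψ₀ φ ψ₁) H1 (to ψ₁ i) (to ψ₁ j) = iso₁ i j
... | left i  | right j rewrite ⊕-↔-inl ψ₀ ψ₁ i | ⊕-↔-inr ψ₀ ψ₁ j | ⊕-lr G0 φ G1 i j
                              | ⊕-lr H0 (conjugate ψ₀ φ ψ₁) H1 (to ψ₀ i) (to ψ₁ j)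
                              | strictlyInverseʳ ψ₀ i = sym (==-to ψ₁ (to φ i) j)
... | right j | left i  rewrite ⊕-↔-inl ψ₀ ψ₁ i | ⊕-↔-inr ψ₀ ψ₁ j | ⊕-rl G0 φ G1 j i
                              | ⊕-rl H0 (conjugate ψ₀ φ ψ₁) H1 (to ψ₁ j) (to ψ₀ i)
                              | strictlyInverseʳ ψ₀ i = sym (==-to ψ₁ (to φ i) j)

⊕-swap : Fin 16 ↔ Fin 16
⊕-swap = ↔-trans (+↔⊎ {8} {8}) (↔-trans swap-↔ (↔-sym (+↔⊎ {8} {8})))

⊕-swap-inl : ∀ i → to ⊕-swap (inl i) ≡ inr i
⊕-swap-inl i rewrite splitAt-↑ˡ 8 i 8 = refl

⊕-swap-inr : ∀ j → to ⊕-swap (inr j) ≡ inl j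
⊕-swap-inr j rewrite splitAt-↑ʳ 8 8 j = refl

⊕-swap⁻¹-inl : ∀ i → from ⊕-swap (inl i) ≡ inr i
⊕-swap⁻¹-inl i rewrite splitAt-↑ˡ 8 i 8 = refl

⊕-comm : ∀ (G0 : Graph 8) φ (G1 : Graph 8) → IsIso (G0 ⊕[ φ ] G1) (G1 ⊕[ ↔-sym φ ] G0) ⊕-swap
⊕-comm G0 φ G1 x y with side {8} {8} x | side {8} {8} y
... | left i  | left j  rewrite ⊕-swap-inl i | ⊕-swap-inl j | ⊕-ll G0 φ G1 i j | ⊕-rr G1 (↔-sym φ) G0 i j = refl
... | right i | right j rewrite ⊕-swap-inr i | ⊕-swap-inr j | ⊕-rr G0 φ G1 i j | ⊕-ll G1 (↔-sym φ) G0 i j = refl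
... | left i  | right j rewrite ⊕-swap-inl i | ⊕-swap-inr j | ⊕-lr G0 φ G1 i j | ⊕-rl G1 (↔-sym φ) G0 i j =
  trans (==-sym (to φ i) j) (sym (==-from φ i j))
... | right j | left i  rewrite ⊕-swap-inr j | ⊕-swap-inl i | ⊕-rl G0 φ G1 j i | ⊕-lr G1 (↔-sym φ) G0 j i =
  trans (==-sym (to φ i) j) (sym (==-from φ i j))

module Sides {G0 G1 : Graph 8} {φ : Fin 8 ↔ Fin 8} (D : Deletion (G0 ⊕[ φ ] G1)) where

  X₀ X₁ : Fin 8 → Bool
  X₀ i = delV D (inl i)
  X₁ j = delV D (inr j)

  E₀ E₁ : Fin 8 → Fin 8 → Bool
  E₀ i j = delE D (inl i) (inl j)
  E₁ i j = delE D (inr i) (inr j)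

  cut : Fin 8 → Bool
  cut a = delE D (inl a) (inr (to φ a))

  -- The vertices a with A a are matched across to φ a; each side is covered without them.
  glue : (A : Fin 8 → Bool) →
         Perfect2Matching G0 (λ i → X₀ i ∨ A i) E₀ → Perfect2Matching G1 (λ j → X₁ j ∨ A (from φ j)) E₁ →
         (∀ a → A a ≡ true → cut a ≡ false × X₀ a ≡ false × X₁ (to φ a) ≡ false) →
         Perfect2Matching (G0 ⊕[ φ ] G1) (delV D) (delE D)
  glue A P₀ P₁ acrossOK = record { σ = σ ; τ = τ ; moves = moves }
    where
      module P₀ = Perfect2Matching P₀
      module P₁ = Perfect2Matching P₁

      σ τ : Fin 16 → Fin 16
      σ x = [ (λ i → if A i then inr (to φ i) else inl (P₀.σ i)) ,
              (λ j → if A (from φ j) then inl (from φ j) else inr (P₁.σ j)) ]′ (splitAt 8 x)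
      τ x = [ (λ i → if A i then inr (to φ i) else inl (P₀.τ i)) ,
              (λ j → if A (from φ j) then inl (from φ j) else inr (P₁.τ j)) ]′ (splitAt 8 x)

      σ-inl : ∀ i → σ (inl i) ≡ (if A i then inr (to φ i) else inl (P₀.σ i))
      σ-inl i rewrite splitAt-↑ˡ 8 i 8 = refl
      τ-inl : ∀ i → τ (inl i) ≡ (if A i then inr (to φ i) else inl (P₀.τ i))
      τ-inl i rewrite splitAt-↑ˡ 8 i 8 = refl
      σ-inr : ∀ j → σ (inr j) ≡ (if A (from φ j) then inl (from φ j) else inr (P₁.σ j))
      σ-inr j rewrite splitAt-↑ʳ 8 8 j = refl
      τ-inr : ∀ j → τ (inr j) ≡ (if A (from φ j) then inl (from φ j) else inr (P₁.τ j))
      τ-inr j rewrite splitAt-↑ʳ 8 8 j = refl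

      ∨-false : ∀ {a b} → a ∨ b ≡ false → a ≡ false × b ≡ false
      ∨-false {false} {false} _ = refl , refl

      cut-sym : ∀ j → cut (from φ j) ≡ delE D (inr j) (inl (from φ j))
      cut-sym j = trans (cong (λ k → delE D (inl (from φ j)) (inr k)) (strictlyInverseˡ φ j)) (delE-sym D _ _)

      moves-inl : ∀ i → X₀ i ≡ false → Moves (G0 ⊕[ φ ] G1) (delV D) (delE D) σ τ (inl i)
      moves-inl i alive rewrite σ-inl i | τ-inl i with A i in Ai
      ... | true with acrossOK i Ai
      ...   | kept , _ , alive′
        rewrite σ-inr (to φ i) | τ-inr (to φ i) | strictlyInverseʳ φ i | Ai
              | ⊕-lr G0 φ G1 i (to φ i) | ==-refl (to φ i) | kept | alive′ = refl , refl , refl , refl , refl , refl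
      moves-inl i alive | false with P₀.moves i (trans (cong (_∨ A i) alive) Ai)
      ... | σ-alive , σ-edge , σ-kept , τ∘σ , τ-alive , σ∘τ
        with ∨-false {X₀ (P₀.σ i)} σ-alive | ∨-false {X₀ (P₀.τ i)} τ-alive
      ...   | σX , σA | τX , τA rewrite τ-inl (P₀.σ i) | σA | τ∘σ | σ-inl (P₀.τ i) | τA | σ∘τ
              | ⊕-ll G0 φ G1 i (P₀.σ i) | σ-edge | σ-kept | σX | τX = refl , refl , refl , refl , refl , refl

      moves-inr : ∀ j → X₁ j ≡ false → Moves (G0 ⊕[ φ ] G1) (delV D) (delE D) σ τ (inr j)
      moves-inr j alive rewrite σ-inr j | τ-inr j with A (from φ j) in Aj
      ... | true with acrossOK (from φ j) Aj
      ...   | kept , alive′ , _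
        rewrite σ-inl (from φ j) | τ-inl (from φ j) | Aj | sym (cut-sym j) | kept
              | ⊕-rl G0 φ G1 j (from φ j) | strictlyInverseˡ φ j | ==-refl j | alive′ = refl , refl , refl , refl , refl , refl
      moves-inr j alive | false with P₁.moves j (trans (cong (_∨ A (from φ j)) alive) Aj)
      ... | σ-alive , σ-edge , σ-kept , τ∘σ , τ-alive , σ∘τ
        with ∨-false {X₁ (P₁.σ j)} σ-alive | ∨-false {X₁ (P₁.τ j)} τ-alive
      ...   | σX , σA | τX , τA rewrite σ-inr (P₁.σ j) | τ-inr (P₁.σ j) | σA | τ∘σ | σ-inr (P₁.τ j) | τA | σ∘τ
              | ⊕-rr G0 φ G1 j (P₁.σ j) | σ-edge | σ-kept | σX | τX = refl , refl , refl , refl , refl , refl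

      moves : ∀ x → delV D x ≡ false → Moves (G0 ⊕[ φ ] G1) (delV D) (delE D) σ τ x
      moves x alive with side {8} {8} x
      ... | left i  = moves-inl i alive
      ... | right j = moves-inr j alive

  size₀ size₁ : ℕ
  size₀ = count X₀ + countPairs E₀
  size₁ = count X₁ + countPairs E₁

  cut-row : ∀ i → count (λ j → delE D (inl i) (inr j)) ≡ fromBool (cut i)
  cut-row i = count-single _ (to φ i) λ j cutij →
    sym (==⇒≡ (trans (sym (⊕-lr G0 φ G1 i j)) (delE-edge D (inl i) (inr j) cutij)))

  size-sides : size D ≡ size₀ + size₁ + count cut
  size-sides = begin
    count (delV D) + countPairs (delE D)
      ≡⟨ cong₂ _+_ (count-↑ 8 8 (delV D)) (countPairs-↑ 8 8 (delE D)) ⟩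
    (count X₀ + count X₁) + (countPairs E₀ + countPairs E₁ + sumℕ (λ i → count (λ j → delE D (inl i) (inr j))))
      ≡⟨ cong (λ c → (count X₀ + count X₁) + (countPairs E₀ + countPairs E₁ + c))
              (trans (sumℕ-cong cut-row) (sym (count≡sumℕ cut))) ⟩
    (count X₀ + count X₁) + (countPairs E₀ + countPairs E₁ + count cut)
      ≡⟨ +-assoc (count X₀ + count X₁) _ _ ⟨
    (count X₀ + count X₁) + (countPairs E₀ + countPairs E₁) + count cut
      ≡⟨ cong (_+ count cut) (interchange (count X₀) _ _ _) ⟩
    size₀ + size₁ + count cut
      ∎
    where open ≡-Reasoning

module _ {G0 G1 : Graph 8} {φ : Fin 8 ↔ Fin 8} (D : Deletion (G0 ⊕[ φ ] G1)) where

  swapped : Deletion (G1 ⊕[ ↔-sym φ ] G0)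
  swapped = mapDeletion ⊕-swap (⊕-comm G0 φ G1) D

  size-swapped : size swapped ≡ size D
  size-swapped = size-mapDeletion {K = G1 ⊕[ ↔-sym φ ] G0} ⊕-swap (⊕-comm G0 φ G1) D

  pullback-swapped : FracPerfectMatching swapped → FracPerfectMatching D
  pullback-swapped = pullbackFPM {K = G1 ⊕[ ↔-sym φ ] G0} ⊕-swap (⊕-comm G0 φ G1) D

  size₀-swapped : Sides.size₀ swapped ≡ Sides.size₁ D
  size₀-swapped = cong₂ _+_ (count-cong (λ i → cong (delV D) (⊕-swap⁻¹-inl i)))
                            (countPairs-cong (λ i j → cong₂ (delE D) (⊕-swap⁻¹-inl i) (⊕-swap⁻¹-inl j)))

-- G(8,4) and its remainder sets

G84-sym : ∀ i j → G84 i j ≡ G84 j i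
G84-sym = toWitness {a? = all? λ i → all? λ j → G84 i j Bool.≟ G84 j i} _

edgeEnds : Vec (Fin 8 × Fin 8) 12
edgeEnds = (0F , 1F) ∷ (0F , 4F) ∷ (0F , 7F) ∷ (1F , 2F) ∷ (1F , 5F) ∷ (2F , 3F)
         ∷ (2F , 6F) ∷ (3F , 4F) ∷ (3F , 7F) ∷ (4F , 5F) ∷ (5F , 6F) ∷ (6F , 7F) ∷ []

edgeIndex : Fin 8 → Fin 8 → Maybe (Fin 12)
edgeIndex 0F 1F = just 0F
edgeIndex 0F 4F = just 1F
edgeIndex 0F 7F = just 2F
edgeIndex 1F 0F = just 0F
edgeIndex 1F 2F = just 3F
edgeIndex 1F 5F = just 4F
edgeIndex 2F 1F = just 3F
edgeIndex 2F 3F = just 5F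
edgeIndex 2F 6F = just 6F
edgeIndex 3F 2F = just 5F
edgeIndex 3F 4F = just 7F
edgeIndex 3F 7F = just 8F
edgeIndex 4F 0F = just 1F
edgeIndex 4F 3F = just 7F
edgeIndex 4F 5F = just 9F
edgeIndex 5F 1F = just 4F
edgeIndex 5F 4F = just 9F
edgeIndex 5F 6F = just (# 10)
edgeIndex 6F 2F = just 6F
edgeIndex 6F 5F = just (# 10)
edgeIndex 6F 7F = just (# 11)
edgeIndex 7F 0F = just 2F
edgeIndex 7F 3F = just 8F
edgeIndex 7F 6F = just (# 11)
edgeIndex _ _ = nothing

-- Dihedral symmetries i ↦ c ± i of G(8,4), one for each of the eight images of R₀ = {v0, v1, v3, v6}.
automorphismTable : Fin 8 → Vec (Fin 8) 8
automorphismTable 0F = (0F ∷ 1F ∷ 2F ∷ 3F ∷ 4F ∷ 5F ∷ 6F ∷ 7F ∷ [])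
automorphismTable 1F = (3F ∷ 2F ∷ 1F ∷ 0F ∷ 7F ∷ 6F ∷ 5F ∷ 4F ∷ [])
automorphismTable 2F = (0F ∷ 7F ∷ 6F ∷ 5F ∷ 4F ∷ 3F ∷ 2F ∷ 1F ∷ [])
automorphismTable 3F = (3F ∷ 4F ∷ 5F ∷ 6F ∷ 7F ∷ 0F ∷ 1F ∷ 2F ∷ [])
automorphismTable 4F = (2F ∷ 1F ∷ 0F ∷ 7F ∷ 6F ∷ 5F ∷ 4F ∷ 3F ∷ [])
automorphismTable 5F = (4F ∷ 3F ∷ 2F ∷ 1F ∷ 0F ∷ 7F ∷ 6F ∷ 5F ∷ [])
automorphismTable 6F = (2F ∷ 3F ∷ 4F ∷ 5F ∷ 6F ∷ 7F ∷ 0F ∷ 1F ∷ [])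
automorphismTable 7F = (4F ∷ 5F ∷ 6F ∷ 7F ∷ 0F ∷ 1F ∷ 2F ∷ 3F ∷ [])

automorphismInverseTable : Fin 8 → Vec (Fin 8) 8
automorphismInverseTable 0F = (0F ∷ 1F ∷ 2F ∷ 3F ∷ 4F ∷ 5F ∷ 6F ∷ 7F ∷ [])
automorphismInverseTable 1F = (3F ∷ 2F ∷ 1F ∷ 0F ∷ 7F ∷ 6F ∷ 5F ∷ 4F ∷ [])
automorphismInverseTable 2F = (0F ∷ 7F ∷ 6F ∷ 5F ∷ 4F ∷ 3F ∷ 2F ∷ 1F ∷ [])
automorphismInverseTable 3F = (5F ∷ 6F ∷ 7F ∷ 0F ∷ 1F ∷ 2F ∷ 3F ∷ 4F ∷ [])
automorphismInverseTable 4F = (2F ∷ 1F ∷ 0F ∷ 7F ∷ 6F ∷ 5F ∷ 4F ∷ 3F ∷ [])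
automorphismInverseTable 5F = (4F ∷ 3F ∷ 2F ∷ 1F ∷ 0F ∷ 7F ∷ 6F ∷ 5F ∷ [])
automorphismInverseTable 6F = (6F ∷ 7F ∷ 0F ∷ 1F ∷ 2F ∷ 3F ∷ 4F ∷ 5F ∷ [])
automorphismInverseTable 7F = (4F ∷ 5F ∷ 6F ∷ 7F ∷ 0F ∷ 1F ∷ 2F ∷ 3F ∷ [])

automorphism : Fin 8 → Fin 8 ↔ Fin 8
automorphism k =
  mk↔ₛ′ (lookup (automorphismTable k)) (lookup (automorphismInverseTable k)) (table-inverseˡ k) (table-inverseʳ k)
  where
    table-inverseˡ : ∀ k v → lookup (automorphismTable k) (lookup (automorphismInverseTable k) v) ≡ v
    table-inverseˡ = toWitness {a? = all? λ k → all? λ v →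
                 lookup (automorphismTable k) (lookup (automorphismInverseTable k) v) ≟ v} _
    table-inverseʳ : ∀ k v → lookup (automorphismInverseTable k) (lookup (automorphismTable k) v) ≡ v
    table-inverseʳ = toWitness {a? = all? λ k → all? λ v →
                 lookup (automorphismInverseTable k) (lookup (automorphismTable k) v) ≟ v} _

automorphism-iso : ∀ k → IsIso G84 G84 (automorphism k)
automorphism-iso = toWitness {a? = all? λ k → all? λ u → all? λ v →
  G84 u v Bool.≟ G84 (to (automorphism k) u) (to (automorphism k) v)} _

remainder remainderᶜ : Fin 8 → Fin 8 → Bool
remainder k v = inRem (to (automorphism k) v)
remainderᶜ k v = not (remainder k v)

count-remainderᶜ : ∀ k → count (remainderᶜ k) ≡ 4
count-remainderᶜ = toWitness {a? = all? λ k → count (remainderᶜ k) ℕ.≟ 4} _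

countPairs-remainderᶜ : ∀ k → countPairs (λ i j → G84 i j ∧ remainderᶜ k i ∧ remainderᶜ k j) ≤ 1
countPairs-remainderᶜ =
  toWitness {a? = all? λ k → countPairs (λ i j → G84 i j ∧ remainderᶜ k i ∧ remainderᶜ k j) ℕ.≤? 1} _

-- v2 and v4 lie outside R₀.
remainderᶜ-pair : ∀ k → Σ (Fin 8) λ a → Σ (Fin 8) λ a′ → remainderᶜ k a ≡ true × remainderᶜ k a′ ≡ true × a ≢ a′
remainderᶜ-pair k = from ψ 2F , from ψ 4F
                  , cong (λ v → not (inRem v)) (strictlyInverseˡ ψ 2F)
                  , cong (λ v → not (inRem v)) (strictlyInverseˡ ψ 4F)
                  , λ e → case (to-injective (↔-sym ψ) e) of λ ()
  where
    ψ : Fin 8 ↔ Fin 8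
    ψ = automorphism k

-- Bits 0–7 mark deleted vertices, bits 8–19 deleted edges in the order of edgeEnds.
Pattern : Set
Pattern = Vec Bool 20

weight : ∀ {n} → Vec Bool n → ℕ
weight v = count (lookup v)

vertexOff : Pattern → Fin 8 → Bool
vertexOff b i = lookup b (i ↑ˡ 12)

edgeOff : Pattern → Fin 12 → Bool
edgeOff b e = lookup b (8 ↑ʳ e)

pairOff : Pattern → Fin 8 → Fin 8 → Bool
pairOff b i j = maybe′ (edgeOff b) false (edgeIndex i j)

edgeOnly : Fin 12 → Fin 8 → Fin 8 → Bool
edgeOnly e i j = maybe′ (_== e) false (edgeIndex i j)

edgeDeletion : (Fin 8 → Fin 8 → Bool) → Fin 12 → Bool
edgeDeletion E e = uncurry E (lookup edgeEnds e)

-- Both sides normalise to sums of the same twelve indicators, bracketed differently.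
count-edgeDeletion : ∀ E → count (edgeDeletion E) ≡ countPairs (λ i j → G84 i j ∧ E i j)
count-edgeDeletion E = solve 12
  (λ x₀ x₁ x₂ x₃ x₄ x₅ x₆ x₇ x₈ x₉ x₁₀ x₁₁ →
       x₀ :+ (x₁ :+ (x₂ :+ (x₃ :+ (x₄ :+ (x₅ :+ (x₆ :+ (x₇ :+ (x₈ :+ (x₉ :+ (x₁₀ :+ (x₁₁ :+ con 0)))))))))))
    := (x₀ :+ (x₁ :+ (x₂ :+ con 0))) :+ ((x₃ :+ (x₄ :+ con 0)) :+ ((x₅ :+ (x₆ :+ con 0)) :+ ((x₇ :+ (x₈ :+ con 0))
       :+ ((x₉ :+ con 0) :+ ((x₁₀ :+ con 0) :+ ((x₁₁ :+ con 0) :+ (con 0 :+ con 0))))))))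
  refl (ind 0F 1F) (ind 0F 4F) (ind 0F 7F) (ind 1F 2F) (ind 1F 5F) (ind 2F 3F)
       (ind 2F 6F) (ind 3F 4F) (ind 3F 7F) (ind 4F 5F) (ind 5F 6F) (ind 6F 7F)
  where
    ind : Fin 8 → Fin 8 → ℕ
    ind i j = fromBool (E i j)

encode : (Fin 8 → Bool) → (Fin 8 → Fin 8 → Bool) → Pattern
encode X E = tabulate λ q → [ X , edgeDeletion E ]′ (splitAt 8 q)

vertexOff-encode : ∀ X E i → vertexOff (encode X E) i ≡ X i
vertexOff-encode X E i rewrite lookup∘tabulate (λ q → [ X , edgeDeletion E ]′ (splitAt 8 q)) (i ↑ˡ 12)
                             | splitAt-↑ˡ 8 i 12 = refl

edgeOff-encode : ∀ X E e → edgeOff (encode X E) e ≡ edgeDeletion E e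
edgeOff-encode X E e rewrite lookup∘tabulate (λ q → [ X , edgeDeletion E ]′ (splitAt 8 q)) (8 ↑ʳ e)
                           | splitAt-↑ʳ 8 12 e = refl

EdgeIndexed : Fin 8 → Fin 8 → Maybe (Fin 12) → Set
EdgeIndexed i j (just e) = lookup edgeEnds e ≡ (i , j) ⊎ lookup edgeEnds e ≡ (j , i)
EdgeIndexed i j nothing  = G84 i j ≡ false

edgeIndex-correct : ∀ i j → EdgeIndexed i j (edgeIndex i j)
edgeIndex-correct = toWitness {a? = all? λ i → all? λ j → edgeIndexed? i j (edgeIndex i j)} _
  where
    edgeIndexed? : ∀ i j m → Dec (EdgeIndexed i j m)
    edgeIndexed? i j (just e) = Product.≡-dec _≟_ _≟_ (lookup edgeEnds e) (i , j)
                        ⊎-dec Product.≡-dec _≟_ _≟_ (lookup edgeEnds e) (j , i)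
    edgeIndexed? i j nothing  = G84 i j Bool.≟ false

pairOff-encode : ∀ X E → (∀ i j → E i j ≡ E j i) → (∀ i j → E i j ≡ true → G84 i j ≡ true) →
                 ∀ i j → pairOff (encode X E) i j ≡ E i j
pairOff-encode X E E-sym E-edge i j with edgeIndex i j | edgeIndex-correct i j
... | just e  | inj₁ ends≡ij = trans (edgeOff-encode X E e) (cong (uncurry E) ends≡ij)
... | just e  | inj₂ ends≡ji = trans (edgeOff-encode X E e) (trans (cong (uncurry E) ends≡ji) (E-sym j i))
... | nothing | nonEdge with E i j in Eij
...   | false = refl
...   | true with () ← trans (sym (E-edge i j Eij)) nonEdge

weight-encode : ∀ X E → (∀ i j → E i j ≡ true → G84 i j ≡ true) → weight (encode X E) ≡ count X + countPairs E
weight-encode X E E-edge = begin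
  count (lookup (encode X E))                   ≡⟨ count-cong (lookup∘tabulate entry) ⟩
  count entry                                   ≡⟨ count-↑ 8 12 entry ⟩
  count (λ (i : Fin 8) → entry (i ↑ˡ 12)) + count (λ e → entry (8 ↑ʳ e))
    ≡⟨ cong₂ _+_ (count-cong (λ (i : Fin 8) → cong [ X , edgeDeletion E ]′ (splitAt-↑ˡ 8 i 12)))
                 (count-cong (λ e → cong [ X , edgeDeletion E ]′ (splitAt-↑ʳ 8 12 e))) ⟩
  count X + count (edgeDeletion E)                         ≡⟨ cong (count X +_) (count-edgeDeletion E) ⟩
  count X + countPairs (λ i j → G84 i j ∧ E i j)           ≡⟨ cong (count X +_) (countPairs-cong onEdges) ⟩
  count X + countPairs E                                   ∎
  where
    open ≡-Reasoning
    entry : Fin 20 → Bool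
    entry q = [ X , edgeDeletion E ]′ (splitAt 8 q)
    onEdges : ∀ i j → (G84 i j ∧ E i j) ≡ E i j
    onEdges i j with E i j in Eij
    ... | true  rewrite E-edge i j Eij = refl
    ... | false = Bool.∧-zeroʳ (G84 i j)

weight≡1 : ∀ {n} (v : Vec Bool n) → weight v ≡ 1 → Σ (Fin n) λ q → ∀ q′ → lookup v q′ ≡ (q′ == q)
weight≡1 (true  ∷ v) w≡1 = F.zero , λ { F.zero → refl ; (F.suc q′) → count≡0⇒false (lookup v) (cong ℕ.pred w≡1) q′ }
weight≡1 (false ∷ v) w≡1 with q , v≡q ← weight≡1 v w≡1 = F.suc q , λ { F.zero → refl ; (F.suc q′) → v≡q q′ }

pairOff-edgeOff : ∀ b (f : Fin 12 → Bool) → (∀ e → edgeOff b e ≡ f e) → ∀ i j → pairOff b i j ≡ maybe′ f false (edgeIndex i j)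
pairOff-edgeOff b f b≗f i j with edgeIndex i j
... | just e  = b≗f e
... | nothing = refl

noEdges : ∀ i j → maybe′ (λ _ → false) false (edgeIndex i j) ≡ false
noEdges i j with edgeIndex i j
... | just _  = refl
... | nothing = refl

weight≡1-cases : ∀ b → weight b ≡ 1 →
  (Σ (Fin 8) λ u₀ → (∀ i → vertexOff b i ≡ (i == u₀)) × (∀ i j → pairOff b i j ≡ false)) ⊎
  (Σ (Fin 12) λ e₀ → (∀ i → vertexOff b i ≡ false) × (∀ i j → pairOff b i j ≡ edgeOnly e₀ i j))
weight≡1-cases b w≡1 with q , b≡q ← weight≡1 b w≡1 with side {8} {12} q
... | left u₀  = inj₁ (u₀ , (λ i → trans (b≡q (i ↑ˡ 12)) (==-↑ˡ 12 i u₀))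
                          , λ i j → trans (pairOff-edgeOff b _ (λ e → trans (b≡q (8 ↑ʳ e)) (↑ʳ==↑ˡ e u₀)) i j) (noEdges i j))
... | right e₀ = inj₂ (e₀ , (λ i → trans (b≡q (i ↑ˡ 12)) (↑ˡ==↑ʳ i e₀))
                          , pairOff-edgeOff b _ (λ e → trans (b≡q (8 ↑ʳ e)) (==-↑ʳ 8 e e₀)))

-- Perfect 2-matchings of G(8,4) minus a few elements, found by certified search

allFin? : ∀ {n} {P : Fin n → Set} → (∀ i → Maybe (P i)) → Maybe (∀ i → P i)
allFin? {zero}  f = just λ ()
allFin? {suc n} f = zipWith (λ p ps → λ { F.zero → p ; (F.suc i) → ps i }) (f F.zero) (allFin? (λ i → f (F.suc i)))

anyFin? : ∀ {n} {P : Fin n → Set} → (∀ i → Maybe (P i)) → Maybe (Σ (Fin n) P)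
anyFin? {zero}  f = nothing
anyFin? {suc n} f = Maybe.map (F.zero ,_) (f F.zero) <∣> Maybe.map (λ (i , p) → F.suc i , p) (anyFin? (λ i → f (F.suc i)))

implies? : ∀ {P : Set} (c : Bool) → Maybe P → Maybe (c ≡ true → P)
implies? true  m = Maybe.map (λ p _ → p) m
implies? false m = just λ ()

moves? : ∀ X Ed (σ τ : Fin 8 → Fin 8) i → Dec (Moves G84 X Ed σ τ i)
moves? X Ed σ τ i =
  X (σ i) Bool.≟ false ×-dec G84 i (σ i) Bool.≟ true ×-dec Ed i (σ i) Bool.≟ false ×-dec
  τ (σ i) ≟ i ×-dec X (τ i) Bool.≟ false ×-dec σ (τ i) ≟ i

perfect2Matching? : ∀ X Ed (σ τ : Fin 8 → Fin 8) → Maybe (Perfect2Matching G84 X Ed)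
perfect2Matching? X Ed σ τ = Maybe.map (λ ok → record { σ = σ ; τ = τ ; moves = ok })
  (dec⇒maybe (all? λ i → X i Bool.≟ false →-dec moves? X Ed σ τ i))

preimage : (Fin 8 → Bool) → (Fin 8 → Fin 8) → Fin 8 → Fin 8
preimage X σ i = maybe′ proj₁ i (anyFin? λ j → dec⇒maybe (X j Bool.≟ false ×-dec σ j ≟ i))

-- Candidate permutations σ for G(8,4) with the given vertices deleted (found by a computer search);
-- the first one compatible with the deleted edges is used.
templateTable : Vec Bool 8 → List (Vec (Fin 8) 8)
templateTable (false ∷ false ∷ false ∷ false ∷ false ∷ false ∷ false ∷ false ∷ []) =
    (1F ∷ 0F ∷ 3F ∷ 2F ∷ 5F ∷ 4F ∷ 7F ∷ 6F ∷ []) ∷ (4F ∷ 2F ∷ 1F ∷ 7F ∷ 0F ∷ 6F ∷ 5F ∷ 3F ∷ []) ∷ (7F ∷ 5F ∷ 6F ∷ 4F ∷ 3F ∷ 1F ∷ 2F ∷ 0F ∷ [])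
  ∷ (1F ∷ 0F ∷ 6F ∷ 7F ∷ 5F ∷ 4F ∷ 2F ∷ 3F ∷ []) ∷ (4F ∷ 5F ∷ 3F ∷ 2F ∷ 0F ∷ 1F ∷ 7F ∷ 6F ∷ []) ∷ (7F ∷ 2F ∷ 1F ∷ 4F ∷ 3F ∷ 6F ∷ 5F ∷ 0F ∷ []) ∷ []
templateTable (true ∷ false ∷ false ∷ false ∷ false ∷ false ∷ false ∷ false ∷ []) =
    (0F ∷ 2F ∷ 1F ∷ 4F ∷ 5F ∷ 6F ∷ 7F ∷ 3F ∷ []) ∷ (0F ∷ 2F ∷ 3F ∷ 4F ∷ 5F ∷ 1F ∷ 7F ∷ 6F ∷ []) ∷ (0F ∷ 2F ∷ 6F ∷ 4F ∷ 5F ∷ 1F ∷ 7F ∷ 3F ∷ []) ∷ []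
templateTable (true ∷ true ∷ false ∷ false ∷ false ∷ false ∷ false ∷ false ∷ []) =
    (0F ∷ 1F ∷ 6F ∷ 7F ∷ 5F ∷ 4F ∷ 2F ∷ 3F ∷ []) ∷ (0F ∷ 1F ∷ 3F ∷ 2F ∷ 5F ∷ 4F ∷ 7F ∷ 6F ∷ []) ∷ []
templateTable (true ∷ true ∷ true ∷ false ∷ false ∷ false ∷ false ∷ false ∷ []) =
    (0F ∷ 1F ∷ 2F ∷ 4F ∷ 5F ∷ 6F ∷ 7F ∷ 3F ∷ []) ∷ []
templateTable (true ∷ true ∷ true ∷ true ∷ false ∷ false ∷ false ∷ false ∷ []) =
    (0F ∷ 1F ∷ 2F ∷ 3F ∷ 5F ∷ 4F ∷ 7F ∷ 6F ∷ []) ∷ []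
templateTable (true ∷ true ∷ true ∷ false ∷ true ∷ false ∷ false ∷ false ∷ []) =
    (0F ∷ 1F ∷ 2F ∷ 7F ∷ 4F ∷ 6F ∷ 5F ∷ 3F ∷ []) ∷ []
templateTable (true ∷ true ∷ true ∷ false ∷ false ∷ true ∷ false ∷ false ∷ []) =
    (0F ∷ 1F ∷ 2F ∷ 4F ∷ 3F ∷ 5F ∷ 7F ∷ 6F ∷ []) ∷ []
templateTable (true ∷ true ∷ true ∷ false ∷ false ∷ false ∷ true ∷ false ∷ []) =
    (0F ∷ 1F ∷ 2F ∷ 7F ∷ 5F ∷ 4F ∷ 6F ∷ 3F ∷ []) ∷ []
templateTable (true ∷ true ∷ true ∷ false ∷ false ∷ false ∷ false ∷ true ∷ []) =
    (0F ∷ 1F ∷ 2F ∷ 4F ∷ 3F ∷ 6F ∷ 5F ∷ 7F ∷ []) ∷ []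
templateTable (true ∷ true ∷ false ∷ true ∷ false ∷ false ∷ false ∷ true ∷ []) =
    (0F ∷ 1F ∷ 6F ∷ 3F ∷ 5F ∷ 4F ∷ 2F ∷ 7F ∷ []) ∷ []
templateTable (true ∷ true ∷ false ∷ false ∷ true ∷ true ∷ false ∷ false ∷ []) =
    (0F ∷ 1F ∷ 6F ∷ 7F ∷ 4F ∷ 5F ∷ 2F ∷ 3F ∷ []) ∷ []
templateTable (true ∷ true ∷ false ∷ false ∷ true ∷ false ∷ false ∷ true ∷ []) =
    (0F ∷ 1F ∷ 3F ∷ 2F ∷ 4F ∷ 6F ∷ 5F ∷ 7F ∷ []) ∷ []
templateTable (true ∷ true ∷ false ∷ false ∷ false ∷ true ∷ false ∷ true ∷ []) =
    (0F ∷ 1F ∷ 6F ∷ 4F ∷ 3F ∷ 5F ∷ 2F ∷ 7F ∷ []) ∷ []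
templateTable (true ∷ true ∷ false ∷ false ∷ false ∷ false ∷ true ∷ true ∷ []) =
    (0F ∷ 1F ∷ 3F ∷ 2F ∷ 5F ∷ 4F ∷ 6F ∷ 7F ∷ []) ∷ []
templateTable (true ∷ true ∷ false ∷ false ∷ false ∷ false ∷ false ∷ true ∷ []) =
    (0F ∷ 1F ∷ 3F ∷ 4F ∷ 5F ∷ 6F ∷ 2F ∷ 7F ∷ []) ∷ []
templateTable (true ∷ false ∷ true ∷ false ∷ false ∷ false ∷ false ∷ false ∷ []) =
    (0F ∷ 5F ∷ 2F ∷ 4F ∷ 3F ∷ 1F ∷ 7F ∷ 6F ∷ []) ∷ []
templateTable (true ∷ false ∷ true ∷ true ∷ true ∷ false ∷ false ∷ false ∷ []) =
    (0F ∷ 5F ∷ 2F ∷ 3F ∷ 4F ∷ 1F ∷ 7F ∷ 6F ∷ []) ∷ []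
templateTable (true ∷ false ∷ true ∷ false ∷ true ∷ false ∷ true ∷ false ∷ []) =
    (0F ∷ 5F ∷ 2F ∷ 7F ∷ 4F ∷ 1F ∷ 6F ∷ 3F ∷ []) ∷ []
templateTable (true ∷ false ∷ true ∷ false ∷ false ∷ false ∷ true ∷ true ∷ []) =
    (0F ∷ 5F ∷ 2F ∷ 4F ∷ 3F ∷ 1F ∷ 6F ∷ 7F ∷ []) ∷ []
templateTable (true ∷ false ∷ false ∷ true ∷ false ∷ false ∷ false ∷ false ∷ []) =
    (0F ∷ 2F ∷ 1F ∷ 3F ∷ 5F ∷ 4F ∷ 7F ∷ 6F ∷ []) ∷ []
templateTable (true ∷ false ∷ false ∷ true ∷ true ∷ true ∷ false ∷ false ∷ []) =
    (0F ∷ 2F ∷ 1F ∷ 3F ∷ 4F ∷ 5F ∷ 7F ∷ 6F ∷ []) ∷ []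
templateTable (true ∷ false ∷ false ∷ true ∷ true ∷ false ∷ false ∷ true ∷ []) =
    (0F ∷ 5F ∷ 6F ∷ 3F ∷ 4F ∷ 1F ∷ 2F ∷ 7F ∷ []) ∷ []
templateTable (true ∷ false ∷ false ∷ true ∷ false ∷ false ∷ true ∷ true ∷ []) =
    (0F ∷ 2F ∷ 1F ∷ 3F ∷ 5F ∷ 4F ∷ 6F ∷ 7F ∷ []) ∷ []
templateTable (true ∷ false ∷ false ∷ false ∷ true ∷ false ∷ false ∷ false ∷ []) =
    (0F ∷ 5F ∷ 6F ∷ 7F ∷ 4F ∷ 1F ∷ 2F ∷ 3F ∷ []) ∷ (0F ∷ 2F ∷ 1F ∷ 7F ∷ 4F ∷ 6F ∷ 5F ∷ 3F ∷ []) ∷ (0F ∷ 5F ∷ 3F ∷ 2F ∷ 4F ∷ 1F ∷ 7F ∷ 6F ∷ []) ∷ []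
templateTable (true ∷ false ∷ false ∷ false ∷ true ∷ true ∷ true ∷ false ∷ []) =
    (0F ∷ 2F ∷ 1F ∷ 7F ∷ 4F ∷ 5F ∷ 6F ∷ 3F ∷ []) ∷ []
templateTable (true ∷ false ∷ false ∷ false ∷ true ∷ false ∷ true ∷ true ∷ []) =
    (0F ∷ 5F ∷ 3F ∷ 2F ∷ 4F ∷ 1F ∷ 6F ∷ 7F ∷ []) ∷ []
templateTable (true ∷ false ∷ false ∷ false ∷ false ∷ true ∷ false ∷ false ∷ []) =
    (0F ∷ 2F ∷ 1F ∷ 4F ∷ 3F ∷ 5F ∷ 7F ∷ 6F ∷ []) ∷ []
templateTable (true ∷ false ∷ false ∷ false ∷ false ∷ false ∷ true ∷ false ∷ []) =
    (0F ∷ 2F ∷ 1F ∷ 7F ∷ 5F ∷ 4F ∷ 6F ∷ 3F ∷ []) ∷ []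
templateTable (true ∷ false ∷ false ∷ false ∷ false ∷ false ∷ true ∷ true ∷ []) =
    (0F ∷ 2F ∷ 3F ∷ 4F ∷ 5F ∷ 1F ∷ 6F ∷ 7F ∷ []) ∷ []
templateTable (true ∷ false ∷ false ∷ false ∷ false ∷ false ∷ false ∷ true ∷ []) =
    (0F ∷ 5F ∷ 6F ∷ 4F ∷ 3F ∷ 1F ∷ 2F ∷ 7F ∷ []) ∷ (0F ∷ 2F ∷ 1F ∷ 4F ∷ 3F ∷ 6F ∷ 5F ∷ 7F ∷ []) ∷ []
templateTable (false ∷ true ∷ false ∷ false ∷ false ∷ false ∷ false ∷ false ∷ []) =
    (4F ∷ 1F ∷ 3F ∷ 2F ∷ 5F ∷ 6F ∷ 7F ∷ 0F ∷ []) ∷ (7F ∷ 1F ∷ 3F ∷ 4F ∷ 5F ∷ 6F ∷ 2F ∷ 0F ∷ []) ∷ (4F ∷ 1F ∷ 3F ∷ 7F ∷ 5F ∷ 6F ∷ 2F ∷ 0F ∷ []) ∷ []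
templateTable (false ∷ true ∷ true ∷ false ∷ false ∷ false ∷ false ∷ false ∷ []) =
    (4F ∷ 1F ∷ 2F ∷ 7F ∷ 0F ∷ 6F ∷ 5F ∷ 3F ∷ []) ∷ (7F ∷ 1F ∷ 2F ∷ 4F ∷ 3F ∷ 6F ∷ 5F ∷ 0F ∷ []) ∷ []
templateTable (false ∷ true ∷ true ∷ true ∷ false ∷ false ∷ false ∷ false ∷ []) =
    (4F ∷ 1F ∷ 2F ∷ 3F ∷ 5F ∷ 6F ∷ 7F ∷ 0F ∷ []) ∷ []
templateTable (false ∷ true ∷ true ∷ true ∷ true ∷ false ∷ false ∷ false ∷ []) =
    (7F ∷ 1F ∷ 2F ∷ 3F ∷ 4F ∷ 6F ∷ 5F ∷ 0F ∷ []) ∷ []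
templateTable (false ∷ true ∷ true ∷ true ∷ false ∷ true ∷ false ∷ false ∷ []) =
    (4F ∷ 1F ∷ 2F ∷ 3F ∷ 0F ∷ 5F ∷ 7F ∷ 6F ∷ []) ∷ []
templateTable (false ∷ true ∷ true ∷ true ∷ false ∷ false ∷ true ∷ false ∷ []) =
    (7F ∷ 1F ∷ 2F ∷ 3F ∷ 5F ∷ 4F ∷ 6F ∷ 0F ∷ []) ∷ []
templateTable (false ∷ true ∷ true ∷ true ∷ false ∷ false ∷ false ∷ true ∷ []) =
    (4F ∷ 1F ∷ 2F ∷ 3F ∷ 0F ∷ 6F ∷ 5F ∷ 7F ∷ []) ∷ []
templateTable (false ∷ true ∷ true ∷ false ∷ false ∷ true ∷ true ∷ false ∷ []) =
    (4F ∷ 1F ∷ 2F ∷ 7F ∷ 0F ∷ 5F ∷ 6F ∷ 3F ∷ []) ∷ []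
templateTable (false ∷ true ∷ false ∷ true ∷ false ∷ false ∷ false ∷ false ∷ []) =
    (7F ∷ 1F ∷ 6F ∷ 3F ∷ 5F ∷ 4F ∷ 2F ∷ 0F ∷ []) ∷ []
templateTable (false ∷ true ∷ false ∷ true ∷ true ∷ true ∷ false ∷ false ∷ []) =
    (7F ∷ 1F ∷ 6F ∷ 3F ∷ 4F ∷ 5F ∷ 2F ∷ 0F ∷ []) ∷ []
templateTable (false ∷ true ∷ false ∷ true ∷ false ∷ true ∷ false ∷ true ∷ []) =
    (4F ∷ 1F ∷ 6F ∷ 3F ∷ 0F ∷ 5F ∷ 2F ∷ 7F ∷ []) ∷ []
templateTable (false ∷ true ∷ false ∷ false ∷ true ∷ false ∷ false ∷ false ∷ []) =
    (7F ∷ 1F ∷ 3F ∷ 2F ∷ 4F ∷ 6F ∷ 5F ∷ 0F ∷ []) ∷ []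
templateTable (false ∷ true ∷ false ∷ false ∷ true ∷ true ∷ true ∷ false ∷ []) =
    (7F ∷ 1F ∷ 3F ∷ 2F ∷ 4F ∷ 5F ∷ 6F ∷ 0F ∷ []) ∷ []
templateTable (false ∷ true ∷ false ∷ false ∷ false ∷ true ∷ false ∷ false ∷ []) =
    (4F ∷ 1F ∷ 6F ∷ 7F ∷ 0F ∷ 5F ∷ 2F ∷ 3F ∷ []) ∷ (4F ∷ 1F ∷ 3F ∷ 2F ∷ 0F ∷ 5F ∷ 7F ∷ 6F ∷ []) ∷ (7F ∷ 1F ∷ 6F ∷ 4F ∷ 3F ∷ 5F ∷ 2F ∷ 0F ∷ []) ∷ []
templateTable (false ∷ true ∷ false ∷ false ∷ false ∷ false ∷ true ∷ false ∷ []) =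
    (7F ∷ 1F ∷ 3F ∷ 2F ∷ 5F ∷ 4F ∷ 6F ∷ 0F ∷ []) ∷ []
templateTable (false ∷ true ∷ false ∷ false ∷ false ∷ false ∷ false ∷ true ∷ []) =
    (4F ∷ 1F ∷ 3F ∷ 2F ∷ 0F ∷ 6F ∷ 5F ∷ 7F ∷ []) ∷ []
templateTable (false ∷ false ∷ true ∷ false ∷ false ∷ false ∷ false ∷ false ∷ []) =
    (1F ∷ 0F ∷ 2F ∷ 4F ∷ 5F ∷ 6F ∷ 7F ∷ 3F ∷ []) ∷ (1F ∷ 5F ∷ 2F ∷ 4F ∷ 3F ∷ 6F ∷ 7F ∷ 0F ∷ []) ∷ (1F ∷ 5F ∷ 2F ∷ 4F ∷ 0F ∷ 6F ∷ 7F ∷ 3F ∷ []) ∷ []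
templateTable (false ∷ false ∷ true ∷ true ∷ false ∷ false ∷ false ∷ false ∷ []) =
    (4F ∷ 5F ∷ 2F ∷ 3F ∷ 0F ∷ 1F ∷ 7F ∷ 6F ∷ []) ∷ (1F ∷ 0F ∷ 2F ∷ 3F ∷ 5F ∷ 4F ∷ 7F ∷ 6F ∷ []) ∷ []
templateTable (false ∷ false ∷ true ∷ true ∷ true ∷ false ∷ false ∷ false ∷ []) =
    (1F ∷ 5F ∷ 2F ∷ 3F ∷ 4F ∷ 6F ∷ 7F ∷ 0F ∷ []) ∷ []
templateTable (false ∷ false ∷ true ∷ true ∷ true ∷ true ∷ false ∷ false ∷ []) =
    (1F ∷ 0F ∷ 2F ∷ 3F ∷ 4F ∷ 5F ∷ 7F ∷ 6F ∷ []) ∷ []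
templateTable (false ∷ false ∷ true ∷ true ∷ true ∷ false ∷ true ∷ false ∷ []) =
    (7F ∷ 5F ∷ 2F ∷ 3F ∷ 4F ∷ 1F ∷ 6F ∷ 0F ∷ []) ∷ []
templateTable (false ∷ false ∷ true ∷ true ∷ true ∷ false ∷ false ∷ true ∷ []) =
    (1F ∷ 0F ∷ 2F ∷ 3F ∷ 4F ∷ 6F ∷ 5F ∷ 7F ∷ []) ∷ []
templateTable (false ∷ false ∷ true ∷ false ∷ true ∷ false ∷ false ∷ false ∷ []) =
    (1F ∷ 0F ∷ 2F ∷ 7F ∷ 4F ∷ 6F ∷ 5F ∷ 3F ∷ []) ∷ []
templateTable (false ∷ false ∷ true ∷ false ∷ false ∷ true ∷ false ∷ false ∷ []) =
    (1F ∷ 0F ∷ 2F ∷ 4F ∷ 3F ∷ 5F ∷ 7F ∷ 6F ∷ []) ∷ []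
templateTable (false ∷ false ∷ true ∷ false ∷ false ∷ true ∷ true ∷ true ∷ []) =
    (1F ∷ 0F ∷ 2F ∷ 4F ∷ 3F ∷ 5F ∷ 6F ∷ 7F ∷ []) ∷ []
templateTable (false ∷ false ∷ true ∷ false ∷ false ∷ false ∷ true ∷ false ∷ []) =
    (4F ∷ 5F ∷ 2F ∷ 7F ∷ 0F ∷ 1F ∷ 6F ∷ 3F ∷ []) ∷ (7F ∷ 5F ∷ 2F ∷ 4F ∷ 3F ∷ 1F ∷ 6F ∷ 0F ∷ []) ∷ (1F ∷ 0F ∷ 2F ∷ 7F ∷ 5F ∷ 4F ∷ 6F ∷ 3F ∷ []) ∷ []
templateTable (false ∷ false ∷ true ∷ false ∷ false ∷ false ∷ false ∷ true ∷ []) =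
    (1F ∷ 0F ∷ 2F ∷ 4F ∷ 3F ∷ 6F ∷ 5F ∷ 7F ∷ []) ∷ []
templateTable (false ∷ false ∷ false ∷ true ∷ false ∷ false ∷ false ∷ false ∷ []) =
    (1F ∷ 2F ∷ 6F ∷ 3F ∷ 5F ∷ 4F ∷ 7F ∷ 0F ∷ []) ∷ (4F ∷ 2F ∷ 1F ∷ 3F ∷ 5F ∷ 6F ∷ 7F ∷ 0F ∷ []) ∷ (4F ∷ 2F ∷ 6F ∷ 3F ∷ 5F ∷ 1F ∷ 7F ∷ 0F ∷ []) ∷ []
templateTable (false ∷ false ∷ false ∷ true ∷ true ∷ false ∷ false ∷ false ∷ []) =
    (7F ∷ 2F ∷ 1F ∷ 3F ∷ 4F ∷ 6F ∷ 5F ∷ 0F ∷ []) ∷ (7F ∷ 5F ∷ 6F ∷ 3F ∷ 4F ∷ 1F ∷ 2F ∷ 0F ∷ []) ∷ []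
templateTable (false ∷ false ∷ false ∷ true ∷ true ∷ true ∷ false ∷ false ∷ []) =
    (1F ∷ 2F ∷ 6F ∷ 3F ∷ 4F ∷ 5F ∷ 7F ∷ 0F ∷ []) ∷ []
templateTable (false ∷ false ∷ false ∷ true ∷ true ∷ true ∷ true ∷ false ∷ []) =
    (7F ∷ 2F ∷ 1F ∷ 3F ∷ 4F ∷ 5F ∷ 6F ∷ 0F ∷ []) ∷ []
templateTable (false ∷ false ∷ false ∷ true ∷ true ∷ true ∷ false ∷ true ∷ []) =
    (1F ∷ 0F ∷ 6F ∷ 3F ∷ 4F ∷ 5F ∷ 2F ∷ 7F ∷ []) ∷ []
templateTable (false ∷ false ∷ false ∷ true ∷ false ∷ true ∷ false ∷ false ∷ []) =
    (4F ∷ 2F ∷ 1F ∷ 3F ∷ 0F ∷ 5F ∷ 7F ∷ 6F ∷ []) ∷ []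
templateTable (false ∷ false ∷ false ∷ true ∷ false ∷ false ∷ true ∷ false ∷ []) =
    (7F ∷ 2F ∷ 1F ∷ 3F ∷ 5F ∷ 4F ∷ 6F ∷ 0F ∷ []) ∷ []
templateTable (false ∷ false ∷ false ∷ true ∷ false ∷ false ∷ false ∷ true ∷ []) =
    (1F ∷ 0F ∷ 6F ∷ 3F ∷ 5F ∷ 4F ∷ 2F ∷ 7F ∷ []) ∷ (4F ∷ 2F ∷ 1F ∷ 3F ∷ 0F ∷ 6F ∷ 5F ∷ 7F ∷ []) ∷ []
templateTable (false ∷ false ∷ false ∷ false ∷ true ∷ false ∷ false ∷ false ∷ []) =
    (1F ∷ 2F ∷ 3F ∷ 7F ∷ 4F ∷ 6F ∷ 5F ∷ 0F ∷ []) ∷ (1F ∷ 5F ∷ 3F ∷ 2F ∷ 4F ∷ 6F ∷ 7F ∷ 0F ∷ []) ∷ (1F ∷ 5F ∷ 3F ∷ 7F ∷ 4F ∷ 6F ∷ 2F ∷ 0F ∷ []) ∷ []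
templateTable (false ∷ false ∷ false ∷ false ∷ true ∷ true ∷ false ∷ false ∷ []) =
    (1F ∷ 0F ∷ 3F ∷ 2F ∷ 4F ∷ 5F ∷ 7F ∷ 6F ∷ []) ∷ (1F ∷ 0F ∷ 6F ∷ 7F ∷ 4F ∷ 5F ∷ 2F ∷ 3F ∷ []) ∷ []
templateTable (false ∷ false ∷ false ∷ false ∷ true ∷ true ∷ true ∷ false ∷ []) =
    (1F ∷ 2F ∷ 3F ∷ 7F ∷ 4F ∷ 5F ∷ 6F ∷ 0F ∷ []) ∷ []
templateTable (false ∷ false ∷ false ∷ false ∷ true ∷ false ∷ true ∷ false ∷ []) =
    (7F ∷ 5F ∷ 3F ∷ 2F ∷ 4F ∷ 1F ∷ 6F ∷ 0F ∷ []) ∷ []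
templateTable (false ∷ false ∷ false ∷ false ∷ true ∷ false ∷ false ∷ true ∷ []) =
    (1F ∷ 0F ∷ 3F ∷ 2F ∷ 4F ∷ 6F ∷ 5F ∷ 7F ∷ []) ∷ []
templateTable (false ∷ false ∷ false ∷ false ∷ false ∷ true ∷ false ∷ false ∷ []) =
    (1F ∷ 2F ∷ 3F ∷ 4F ∷ 0F ∷ 5F ∷ 7F ∷ 6F ∷ []) ∷ (1F ∷ 2F ∷ 6F ∷ 4F ∷ 3F ∷ 5F ∷ 7F ∷ 0F ∷ []) ∷ (1F ∷ 2F ∷ 6F ∷ 4F ∷ 0F ∷ 5F ∷ 7F ∷ 3F ∷ []) ∷ []
templateTable (false ∷ false ∷ false ∷ false ∷ false ∷ true ∷ true ∷ false ∷ []) =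
    (4F ∷ 2F ∷ 1F ∷ 7F ∷ 0F ∷ 5F ∷ 6F ∷ 3F ∷ []) ∷ (7F ∷ 2F ∷ 1F ∷ 4F ∷ 3F ∷ 5F ∷ 6F ∷ 0F ∷ []) ∷ []
templateTable (false ∷ false ∷ false ∷ false ∷ false ∷ true ∷ true ∷ true ∷ []) =
    (1F ∷ 2F ∷ 3F ∷ 4F ∷ 0F ∷ 5F ∷ 6F ∷ 7F ∷ []) ∷ []
templateTable (false ∷ false ∷ false ∷ false ∷ false ∷ true ∷ false ∷ true ∷ []) =
    (1F ∷ 0F ∷ 6F ∷ 4F ∷ 3F ∷ 5F ∷ 2F ∷ 7F ∷ []) ∷ []
templateTable (false ∷ false ∷ false ∷ false ∷ false ∷ false ∷ true ∷ false ∷ []) =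
    (1F ∷ 2F ∷ 3F ∷ 7F ∷ 5F ∷ 4F ∷ 6F ∷ 0F ∷ []) ∷ (7F ∷ 2F ∷ 3F ∷ 4F ∷ 5F ∷ 1F ∷ 6F ∷ 0F ∷ []) ∷ (4F ∷ 2F ∷ 3F ∷ 7F ∷ 5F ∷ 1F ∷ 6F ∷ 0F ∷ []) ∷ []
templateTable (false ∷ false ∷ false ∷ false ∷ false ∷ false ∷ true ∷ true ∷ []) =
    (1F ∷ 0F ∷ 3F ∷ 2F ∷ 5F ∷ 4F ∷ 6F ∷ 7F ∷ []) ∷ (4F ∷ 5F ∷ 3F ∷ 2F ∷ 0F ∷ 1F ∷ 6F ∷ 7F ∷ []) ∷ []
templateTable (false ∷ false ∷ false ∷ false ∷ false ∷ false ∷ false ∷ true ∷ []) =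
    (1F ∷ 0F ∷ 3F ∷ 4F ∷ 5F ∷ 6F ∷ 2F ∷ 7F ∷ []) ∷ (1F ∷ 2F ∷ 3F ∷ 4F ∷ 0F ∷ 6F ∷ 5F ∷ 7F ∷ []) ∷ (1F ∷ 5F ∷ 3F ∷ 4F ∷ 0F ∷ 6F ∷ 2F ∷ 7F ∷ []) ∷ []
templateTable _ = []

findPerfect2Matching : ∀ X Ed → Maybe (Perfect2Matching G84 X Ed)
findPerfect2Matching X Ed =
  foldr (λ s rest → perfect2Matching? X Ed (lookup s) (preimage X (lookup s)) <∣> rest) nothing (templateTable (tabulate X))

Removable : (Fin 8 → Bool) → (Fin 8 → Fin 8 → Bool) → (Fin 8 → Bool) → Set
Removable X Ed A = (∀ a → A a ≡ true → X a ≡ false) × Perfect2Matching G84 (λ i → X i ∨ A i) Ed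

removable? : ∀ X Ed A → Maybe (Removable X Ed A)
removable? X Ed A =
  zipWith _,_ (allFin? λ a → implies? (A a) (dec⇒maybe (X a Bool.≟ false))) (findPerfect2Matching (λ i → X i ∨ A i) Ed)

RemovableOutside : Pattern → Fin 8 → Set
RemovableOutside b k = ∀ a → remainderᶜ k a ≡ true → Removable (vertexOff b) (pairOff b) (_== a)

data Cover (b : Pattern) : Set where
  direct       : Perfect2Matching G84 (vertexOff b) (pairOff b) → Cover b
  viaPair      : weight b ≡ 3 → (a₁ a₂ : Fin 8) → Removable (vertexOff b) (pairOff b) (λ i → (i == a₁) ∨ (i == a₂)) →
                 Cover b
  viaRemainder : weight b ≡ 2 → (k : Fin 8) → RemovableOutside b k → Cover b

cover? : (b : Pattern) → Maybe (Cover b)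
cover? b = Maybe.map direct (findPerfect2Matching (vertexOff b) (pairOff b)) <∣> indirect (weight b ℕ.≟ 3) (weight b ℕ.≟ 2)
  where
    indirect : Dec (weight b ≡ 3) → Dec (weight b ≡ 2) → Maybe (Cover b)
    indirect (yes w≡3) _ = Maybe.map (λ (a₁ , a₂ , rm) → viaPair w≡3 a₁ a₂ rm)
      (anyFin? λ a₁ → anyFin? λ a₂ → removable? (vertexOff b) (pairOff b) (λ i → (i == a₁) ∨ (i == a₂)))
    indirect (no _) (yes w≡2) = Maybe.map (λ (k , rm) → viaRemainder w≡2 k rm)
      (anyFin? λ k → allFin? λ a → implies? (remainderᶜ k a) (removable? (vertexOff b) (pairOff b) (_== a)))
    indirect (no _) (no _) = nothing

allOfWeight≤? : ∀ n k {P : Vec Bool n → Set} → (∀ v → Maybe (P v)) → Maybe (∀ v → weight v ≤ k → P v)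
allOfWeight≤? zero    k       f = Maybe.map (λ { p [] _ → p }) (f [])
allOfWeight≤? (suc n) zero    f = Maybe.map (λ { p (false ∷ v) w → p v w ; p (true ∷ v) () })
                                      (allOfWeight≤? n zero (λ v → f (false ∷ v)))
allOfWeight≤? (suc n) (suc k) f = zipWith (λ { p q (false ∷ v) w → p v w ; p q (true ∷ v) (s≤s w) → q v w })
                                          (allOfWeight≤? n (suc k) (λ v → f (false ∷ v)))
                                          (allOfWeight≤? n k (λ v → f (true ∷ v)))

opaque
  covers : ∀ b → weight b ≤ 3 → Cover b
  covers = from-just (allOfWeight≤? 20 3 cover?)

opaque
  twoVerticesRemoved : ∀ u v → Perfect2Matching G84 (λ i → (i == u) ∨ (i == v)) (λ _ _ → false)
  twoVerticesRemoved = from-just (allFin? λ u → allFin? λ v → findPerfect2Matching (λ i → (i == u) ∨ (i == v)) (λ _ _ → false))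

opaque
  edgeThenVertex : ∀ e → Σ (Fin 8) λ k′ → ∀ u → remainder k′ u ≡ true → Perfect2Matching G84 (_== u) (edgeOnly e)
  edgeThenVertex = from-just (allFin? λ e → anyFin? λ k′ → allFin? λ u →
    implies? (remainder k′ u) (findPerfect2Matching (_== u) (edgeOnly e)))

Aligned : Fin 8 ↔ Fin 8 → Fin 8 → Fin 8 → Set
Aligned φ k k′ = ∀ a → remainderᶜ k a ≡ true → remainderᶜ k′ (to φ a) ≡ true

AlignedRemainders : Fin 8 ↔ Fin 8 → Set
AlignedRemainders φ = Σ (Fin 8) λ k → Σ (Fin 8) λ k′ → Aligned φ k k′

RemainderBound : Fin 8 ↔ Fin 8 → Set
RemainderBound φ = Σ (Fin 8) λ k → countPairs (λ i j → G84 i j ∧ remainderᶜ k (from φ i) ∧ remainderᶜ k (from φ j)) ≤ 1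

remainderBound : ∀ φ k k′ → (∀ v → remainderᶜ k (from φ v) ≡ remainderᶜ k′ v) → RemainderBound φ
remainderBound φ k k′ moved = k , subst (_≤ 1) (sym (countPairs-cong same)) (countPairs-remainderᶜ k′)
  where
    same : ∀ i j → (G84 i j ∧ remainderᶜ k (from φ i) ∧ remainderᶜ k (from φ j)) ≡ (G84 i j ∧ remainderᶜ k′ i ∧ remainderᶜ k′ j)
    same i j = cong₂ (λ a b → G84 i j ∧ a ∧ b) (moved i) (moved j)

count-remainderᶜ-moved : ∀ (φ : Fin 8 ↔ Fin 8) k → count (λ v → remainderᶜ k (from φ v)) ≡ 4
count-remainderᶜ-moved φ k = trans (count-permute (remainderᶜ k) (↔-sym φ)) (count-remainderᶜ k)

-- Both sets have four elements, so the inclusion given by alignment is an equality.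
aligned⇒bound : ∀ φ → AlignedRemainders φ → RemainderBound φ
aligned⇒bound φ (k , k′ , aligned) = remainderBound φ k k′
  (count-mono-≡ (λ v inside → subst (λ w → remainderᶜ k′ w ≡ true) (strictlyInverseˡ φ v) (aligned (from φ v) inside))
                (trans (count-remainderᶜ-moved φ k) (sym (count-remainderᶜ k′))))

aligned⁻¹⇒bound : ∀ φ → AlignedRemainders (↔-sym φ) → RemainderBound φ
aligned⁻¹⇒bound φ (k , k′ , aligned) = remainderBound φ k′ k λ v →
  sym (count-mono-≡ aligned (trans (count-remainderᶜ k) (sym (count-remainderᶜ-moved φ k′))) v)

-- Deletions of size three in G(8,4) ⊕_φ G(8,4)

weight≡0-cases : ∀ b → weight b ≡ 0 → (∀ i → vertexOff b i ≡ false) × (∀ i j → pairOff b i j ≡ false)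
weight≡0-cases b w≡0 = (λ i → count≡0⇒false (lookup b) w≡0 _)
                     , λ i j → trans (pairOff-edgeOff b _ (λ e → count≡0⇒false (lookup b) w≡0 _) i j) (noEdges i j)

light-cover : ∀ b → weight b ≤ 1 → Perfect2Matching G84 (vertexOff b) (pairOff b)
light-cover b w≤1 with covers b (≤-trans w≤1 (s≤s z≤n))
... | direct P = P
... | viaPair w≡3 _ _ _ with s≤s () ← subst (_≤ 1) w≡3 w≤1
... | viaRemainder w≡2 _ _ with s≤s () ← subst (_≤ 1) w≡2 w≤1

+≡1 : ∀ m n → m + n ≡ 1 → (m ≡ 1 × n ≡ 0) ⊎ (m ≡ 0 × n ≡ 1)
+≡1 1 0 _ = inj₁ (refl , refl)
+≡1 0 1 _ = inj₂ (refl , refl)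
+≡1 0 (suc (suc n)) ()
+≡1 1 (suc n) ()
+≡1 (suc (suc m)) n ()

module SizeThree (φ : Fin 8 ↔ Fin 8) (D : Deletion (G84 ⊕[ φ ] G84)) where

  open Sides D

  b₀ b₁ : Pattern
  b₀ = encode X₀ E₀
  b₁ = encode X₁ E₁

  E₀-edge : ∀ i j → E₀ i j ≡ true → G84 i j ≡ true
  E₀-edge i j e = trans (sym (⊕-ll G84 φ G84 i j)) (delE-edge D _ _ e)

  E₁-edge : ∀ i j → E₁ i j ≡ true → G84 i j ≡ true
  E₁-edge i j e = trans (sym (⊕-rr G84 φ G84 i j)) (delE-edge D _ _ e)

  X₀-b₀ : ∀ i → vertexOff b₀ i ≡ X₀ i
  X₀-b₀ = vertexOff-encode X₀ E₀
  X₁-b₁ : ∀ i → vertexOff b₁ i ≡ X₁ i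
  X₁-b₁ = vertexOff-encode X₁ E₁
  E₀-b₀ : ∀ i j → pairOff b₀ i j ≡ E₀ i j
  E₀-b₀ = pairOff-encode X₀ E₀ (λ i j → delE-sym D _ _) E₀-edge
  E₁-b₁ : ∀ i j → pairOff b₁ i j ≡ E₁ i j
  E₁-b₁ = pairOff-encode X₁ E₁ (λ i j → delE-sym D _ _) E₁-edge

  weight-b₀ : weight b₀ ≡ size₀
  weight-b₀ = weight-encode X₀ E₀ E₀-edge
  weight-b₁ : weight b₁ ≡ size₁
  weight-b₁ = weight-encode X₁ E₁ E₁-edge

  matchAcross : (A : Fin 8 → Bool) → Removable (vertexOff b₀) (pairOff b₀) A →
                Perfect2Matching G84 (λ j → X₁ j ∨ A (from φ j)) E₁ →
                (∀ a → A a ≡ true → cut a ≡ false × X₁ (to φ a) ≡ false) → FracPerfectMatching D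
  matchAcross A (A-alive , P₀) P₁ across = perfect2Matching⇒fpm (⊕-sym G84 φ G84 G84-sym G84-sym) D
    (glue A (Perfect2Matching-cong (λ i → cong (_∨ A i) (X₀-b₀ i)) E₀-b₀ P₀) P₁ across′)
    where
      across′ : ∀ a → A a ≡ true → cut a ≡ false × X₀ a ≡ false × X₁ (to φ a) ≡ false
      across′ a Aa = proj₁ (across a Aa) , trans (sym (X₀-b₀ a)) (A-alive a Aa) , proj₂ (across a Aa)

  matchOneAcross : ∀ a → Removable (vertexOff b₀) (pairOff b₀) (_== a) → cut a ≡ false → X₁ (to φ a) ≡ false →
                   Perfect2Matching G84 (λ j → X₁ j ∨ (j == to φ a)) E₁ → FracPerfectMatching D
  matchOneAcross a rm cut≡false alive P₁ = matchAcross (_== a) rm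
    (Perfect2Matching-cong (λ j → cong (X₁ j ∨_) (sym (==-from φ a j))) (λ _ _ → refl) P₁)
    λ a′ a′==a → subst (λ c → cut c ≡ false × X₁ (to φ c) ≡ false) (sym (==⇒≡ a′==a)) (cut≡false , alive)

  side₁-empty : size₁ ≡ 0 → (∀ j → X₁ j ≡ false) × (∀ i j → E₁ i j ≡ false)
  side₁-empty size₁≡0 with X≡false , E≡false ← weight≡0-cases b₁ (trans weight-b₁ size₁≡0) =
    (λ j → trans (sym (X₁-b₁ j)) (X≡false j)) , λ i j → trans (sym (E₁-b₁ i j)) (E≡false i j)

  oneVertexRemoved : ∀ u → Perfect2Matching G84 (_== u) (λ _ _ → false)
  oneVertexRemoved u = Perfect2Matching-cong (λ j → Bool.∨-idem (j == u)) (λ _ _ → refl) (twoVerticesRemoved u u)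

  noneAcross : Perfect2Matching G84 (vertexOff b₀) (pairOff b₀) → Perfect2Matching G84 (vertexOff b₁) (pairOff b₁) →
               FracPerfectMatching D
  noneAcross P₀ P₁ = matchAcross (λ _ → false)
    ((λ _ ()) , Perfect2Matching-cong (λ i → sym (Bool.∨-identityʳ _)) (λ _ _ → refl) P₀)
    (Perfect2Matching-cong (λ j → trans (X₁-b₁ j) (sym (Bool.∨-identityʳ _))) E₁-b₁ P₁)
    (λ _ ())

  twoAcross : size₁ ≡ 0 → count cut ≡ 0 → ∀ a₁ a₂ → Removable (vertexOff b₀) (pairOff b₀) (λ i → (i == a₁) ∨ (i == a₂)) →
              FracPerfectMatching D
  twoAcross size₁≡0 uncut a₁ a₂ rm with X≡false , E≡false ← side₁-empty size₁≡0 =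
    matchAcross (λ i → (i == a₁) ∨ (i == a₂)) rm
      (Perfect2Matching-cong X≗ (λ i j → sym (E≡false i j)) (twoVerticesRemoved (to φ a₁) (to φ a₂)))
      (λ a _ → count≡0⇒false cut uncut a , X≡false (to φ a))
    where
      X≗ : ∀ j → ((j == to φ a₁) ∨ (j == to φ a₂)) ≡ X₁ j ∨ ((from φ j == a₁) ∨ (from φ j == a₂))
      X≗ j rewrite X≡false j | ==-from φ a₁ j | ==-from φ a₂ j = refl

  acrossEmpty : size₁ ≡ 0 → ∀ c → Removable (vertexOff b₀) (pairOff b₀) (_== c) → cut c ≡ false → FracPerfectMatching D
  acrossEmpty size₁≡0 c rm uncut with X≡false , E≡false ← side₁-empty size₁≡0 =
    matchOneAcross c rm uncut (X≡false (to φ c))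
      (Perfect2Matching-cong (λ j → sym (cong (_∨ (j == to φ c)) (X≡false j))) (λ i j → sym (E≡false i j))
                             (oneVertexRemoved (to φ c)))

  cutOnce : size₁ ≡ 0 → count cut ≡ 1 → ∀ k → RemovableOutside b₀ k → FracPerfectMatching D
  cutOnce size₁≡0 cutOne k rm with a , a′ , ra , ra′ , a≢a′ ← remainderᶜ-pair k | cut a in cut-a | cut a′ in cut-a′
  ... | false | _     = acrossEmpty size₁≡0 a (rm a ra) cut-a
  ... | true  | false = acrossEmpty size₁≡0 a′ (rm a′ ra′) cut-a′
  ... | true  | true  with s≤s () ← subst (2 ≤_) cutOne (2≤count cut cut-a cut-a′ a≢a′)

  acrossAvoiding : count cut ≡ 0 → ∀ u₀ → (∀ j → X₁ j ≡ (j == u₀)) → (∀ i j → E₁ i j ≡ false) →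
                   ∀ c → Removable (vertexOff b₀) (pairOff b₀) (_== c) → to φ c ≢ u₀ → FracPerfectMatching D
  acrossAvoiding uncut u₀ X≡u₀ E≡false c rm φc≢u₀ =
    matchOneAcross c rm (count≡0⇒false cut uncut c) (trans (X≡u₀ (to φ c)) (≢⇒==-false φc≢u₀))
      (Perfect2Matching-cong (λ j → cong (_∨ (j == to φ c)) (sym (X≡u₀ j))) (λ i j → sym (E≡false i j))
                             (twoVerticesRemoved u₀ (to φ c)))

  vertexDeleted : count cut ≡ 0 → ∀ u₀ → (∀ j → X₁ j ≡ (j == u₀)) → (∀ i j → E₁ i j ≡ false) →
                  ∀ k → RemovableOutside b₀ k → FracPerfectMatching D
  vertexDeleted uncut u₀ X≡u₀ E≡false k rm with a , a′ , ra , ra′ , a≢a′ ← remainderᶜ-pair k | to φ a ≟ u₀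
  ... | no φa≢u₀  = acrossAvoiding uncut u₀ X≡u₀ E≡false a (rm a ra) φa≢u₀
  ... | yes φa≡u₀ = acrossAvoiding uncut u₀ X≡u₀ E≡false a′ (rm a′ ra′)
                      λ φa′≡u₀ → a≢a′ (to-injective φ (trans φa≡u₀ (sym φa′≡u₀)))

  edgeDeleted : count cut ≡ 0 → ∀ e₀ → (∀ j → X₁ j ≡ false) → (∀ i j → E₁ i j ≡ edgeOnly e₀ i j) →
                ∀ k → RemovableOutside b₀ k → FracPerfectMatching D ⊎ AlignedRemainders φ
  edgeDeleted uncut e₀ X≡false E≡e₀ k rm
    with k′ , removable ← edgeThenVertex e₀
       | any? (λ a → remainderᶜ k a Bool.≟ true ×-dec remainder k′ (to φ a) Bool.≟ true)
  ... | yes (a , ra , rφa) = inj₁ (matchOneAcross a (rm a ra) (count≡0⇒false cut uncut a) (X≡false (to φ a))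
          (Perfect2Matching-cong (λ j → sym (cong (_∨ (j == to φ a)) (X≡false j))) (λ i j → sym (E≡e₀ i j))
                                 (removable (to φ a) rφa)))
  ... | no none = inj₂ (k , k′ , aligned)
    where
      aligned : Aligned φ k k′
      aligned a ra with remainder k′ (to φ a) in rφa
      ... | false = refl
      ... | true  = ⊥-elim (none (a , ra , rφa))

  singleDeletion₁ : size₁ ≡ 1 → count cut ≡ 0 → ∀ k → RemovableOutside b₀ k →
                    FracPerfectMatching D ⊎ AlignedRemainders φ
  singleDeletion₁ size₁≡1 uncut k rm = [ vertex , edge ]′ (weight≡1-cases b₁ (trans weight-b₁ size₁≡1))
    where
      vertex : (Σ (Fin 8) λ u₀ → (∀ i → vertexOff b₁ i ≡ (i == u₀)) × (∀ i j → pairOff b₁ i j ≡ false)) →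
               FracPerfectMatching D ⊎ AlignedRemainders φ
      vertex (u₀ , X≡u₀ , E≡∅) = inj₁ (vertexDeleted uncut u₀ (λ j → trans (sym (X₁-b₁ j)) (X≡u₀ j))
                                                              (λ i j → trans (sym (E₁-b₁ i j)) (E≡∅ i j)) k rm)
      edge : (Σ (Fin 12) λ e₀ → (∀ i → vertexOff b₁ i ≡ false) × (∀ i j → pairOff b₁ i j ≡ edgeOnly e₀ i j)) →
             FracPerfectMatching D ⊎ AlignedRemainders φ
      edge (e₀ , X≡∅ , E≡e₀) = edgeDeleted uncut e₀ (λ j → trans (sym (X₁-b₁ j)) (X≡∅ j))
                                                    (λ i j → trans (sym (E₁-b₁ i j)) (E≡e₀ i j)) k rm

  module _ (size≡3 : size D ≡ 3) (2≤size₀ : 2 ≤ size₀) where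

    private
      sizes : size₀ + (size₁ + count cut) ≡ 3
      sizes = trans (sym (+-assoc size₀ size₁ (count cut))) (trans (sym size-sides) size≡3)

      size₀≤3 : size₀ ≤ 3
      size₀≤3 = subst (size₀ ≤_) sizes (m≤m+n size₀ _)

      rest≤1 : size₁ + count cut ≤ 1
      rest≤1 = +-cancelˡ-≤ 2 _ 1 (subst (2 + (size₁ + count cut) ≤_) sizes (+-monoˡ-≤ _ 2≤size₀))

      rest-of : ∀ m → weight b₀ ≡ m → m + (size₁ + count cut) ≡ 3
      rest-of m w≡m = subst (λ s → s + (size₁ + count cut) ≡ 3) (trans (sym weight-b₀) w≡m) sizes

      fromCover : Cover b₀ → FracPerfectMatching D ⊎ AlignedRemainders φ
      fromCover (direct P₀) =
        inj₁ (noneAcross P₀ (light-cover b₁ (subst (_≤ 1) (sym weight-b₁) (≤-trans (m≤m+n size₁ _) rest≤1))))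
      fromCover (viaPair w≡3 a₁ a₂ rm) =
        inj₁ (twoAcross (m+n≡0⇒m≡0 size₁ rest≡0) (m+n≡0⇒n≡0 size₁ rest≡0) a₁ a₂ rm)
        where
          rest≡0 : size₁ + count cut ≡ 0
          rest≡0 = +-cancelˡ-≡ 3 _ 0 (rest-of 3 w≡3)
      fromCover (viaRemainder w≡2 k rm) =
        [ (λ (size₁≡1 , uncut) → singleDeletion₁ size₁≡1 uncut k rm) ,
          (λ (size₁≡0 , cutOne) → inj₁ (cutOnce size₁≡0 cutOne k rm)) ]′
        (+≡1 size₁ (count cut) (+-cancelˡ-≡ 2 _ 1 (rest-of 2 w≡2)))

    side₀-heavy : FracPerfectMatching D ⊎ AlignedRemainders φ
    side₀-heavy = fromCover (covers b₀ (subst (_≤ 3) (sym weight-b₀) size₀≤3))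

fpm-or-bound : ∀ φ (D : Deletion (G84 ⊕[ φ ] G84)) → size D ≡ 3 → FracPerfectMatching D ⊎ RemainderBound φ
fpm-or-bound φ D size≡3 with 2 ≤? Sides.size₀ D | 2 ≤? Sides.size₁ D
... | yes 2≤size₀ | _ = map₂ (aligned⇒bound φ) (SizeThree.side₀-heavy φ D size≡3 2≤size₀)
... | no _ | yes 2≤size₁ =
  Sum.map (pullback-swapped D) (aligned⁻¹⇒bound φ)
      (SizeThree.side₀-heavy (↔-sym φ) (swapped D) (trans (size-swapped D) size≡3)
                       (subst (2 ≤_) (sym (size₀-swapped D)) 2≤size₁))
... | no size₀≱2 | no size₁≱2 =
  inj₁ (noneAcross (light-cover b₀ (light size₀≱2 weight-b₀)) (light-cover b₁ (light size₁≱2 weight-b₁)))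
  where
    open SizeThree φ D
    light : ∀ {w s} → ¬ 2 ≤ s → w ≡ s → w ≤ 1
    light s≱2 refl = ≤-pred (≰⇒> s≱2)

edgesAfterRemoving-pullback : ∀ {G1 : Graph 8} (ψ₀ φ ψ₁ : Fin 8 ↔ Fin 8) → IsIso G1 G84 ψ₁ → ∀ k →
  edgesAfterRemoving G1 φ (λ v → remainder k (to ψ₀ v))
    ≡ countPairs (λ i j → G84 i j ∧ remainderᶜ k (from (conjugate ψ₀ φ ψ₁) i) ∧ remainderᶜ k (from (conjugate ψ₀ φ ψ₁) j))
edgesAfterRemoving-pullback {G1} ψ₀ φ ψ₁ iso₁ k =
  trans (countPairs-cong pointwise) (countPairs-permute q ψ₁ q-sym)
  where
    q : Fin 8 → Fin 8 → Bool
    q x y = G84 x y ∧ remainderᶜ k (from (conjugate ψ₀ φ ψ₁) x) ∧ remainderᶜ k (from (conjugate ψ₀ φ ψ₁) y)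
    q-sym : ∀ x y → q x y ≡ q y x
    q-sym x y = cong₂ _∧_ (G84-sym x y) (Bool.∧-comm (remainderᶜ k (from (conjugate ψ₀ φ ψ₁) x)) _)
    pointwise : ∀ i j → (G1 i j ∧ not (remainder k (to ψ₀ (from φ i))) ∧ not (remainder k (to ψ₀ (from φ j))))
                      ≡ q (to ψ₁ i) (to ψ₁ j)
    pointwise i j rewrite strictlyInverseʳ ψ₁ i | strictlyInverseʳ ψ₁ j = cong (_∧ _) (iso₁ i j)

lemma3p5 : (G0 G1 : Graph 8) (φ : Fin 8 ↔ Fin 8) →
    Isomorphic G0 G84 → Isomorphic G1 G84 →
    FsmpEq (G0 ⊕[ φ ] G1) 3 →
    Σ (Fin 8 → Bool) λ R → IsRemainderSet G0 R × edgesAfterRemoving G1 φ R ≤ 1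
lemma3p5 G0 G1 φ (ψ₀ , iso₀) (ψ₁ , iso₁) ((D , noFPM , size≡3) , _) =
  [ (λ M → ⊥-elim (noFPM (pullbackFPM {K = K} (⊕-↔ ψ₀ ψ₁) iso D M))) , remainderSet ]′
  (fpm-or-bound (conjugate ψ₀ φ ψ₁) (mapDeletion (⊕-↔ ψ₀ ψ₁) iso D)
                (trans (size-mapDeletion {K = K} (⊕-↔ ψ₀ ψ₁) iso D) size≡3))
  where
    K : Graph 16
    K = G84 ⊕[ conjugate ψ₀ φ ψ₁ ] G84
    iso : IsIso (G0 ⊕[ φ ] G1) K (⊕-↔ ψ₀ ψ₁)
    iso = ⊕-cong ψ₀ φ ψ₁ iso₀ iso₁
    remainderSet : RemainderBound (conjugate ψ₀ φ ψ₁) →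
                   Σ (Fin 8 → Bool) λ R → IsRemainderSet G0 R × edgesAfterRemoving G1 φ R ≤ 1
    remainderSet (k , bound) =
        (λ v → remainder k (to ψ₀ v))
      , (↔-trans ψ₀ (automorphism k) , (λ u v → trans (iso₀ u v) (automorphism-iso k _ _)) , λ v → refl)
      , subst (_≤ 1) (sym (edgesAfterRemoving-pullback ψ₀ φ ψ₁ iso₁ k)) bound
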